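{- Let $d \geq 1$. Then (i) the matrices $\mathfrak{F}_{d-1}$ and $\mathfrak{H}_{d-1}$ are similar; (ii) $\mathfrak{F}_{d-1}$ and $\mathfrak{H}_{d-1}$ are diagonalizable, with eigenvalue $1$ of multiplicity $2$ and eigenvalues $2!, 3!, \ldots, d!$ each of multiplicity $1$; in particular there is a basis of $\mathbb{R}^{d+1}$ consisting of rational eigenvectors.
   Context: $S(n,k)$ denotes the Stirling numbers of the second kind (with $S(0,0)=1$). $\mathfrak{F}_{d-1}=(F_{ij})_{0\le i,j\le d}$ is the $(d+1)\times(d+1)$ matrix with $F_{ij} = i!\,S(j,i)$; this is the matrix with $\mathfrak{f}^{\mathrm{sd}(\Delta)} = \mathfrak{F}_{d-1}\mathfrak{f}^\Delta$ for the $f$-vectors $\mathfrak f=(f_{ -1},\dots,f_{d-1})$ of a $(d-1)$-dimensional Boolean cell complex and its barycentric subdivision. For $\sigma \in S_m$, $\mathrm{des}(\sigma) = \#\{ k \in [m-1] : \sigma(k) > \sigma(k+1)\}$, and $A(m,i,j)$ is the number of $\sigma\in S_m$ with $\sigma(1)=j$ and $\mathrm{des}(\sigma)=i$. $\mathfrak{H}_{d-1}=(H_{ij})_{0\le i,j\le d}$ is the $(d+1)\times(d+1)$ matrix with $H_{ij}=A(d+1,i,j+1)$. -}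

module Defs where

open import Data.Nat as ℕ using (ℕ; zero; suc)
open import Data.Nat using (_!)
open import Data.Fin as Fin using (Fin; toℕ)
open import Data.Fin.Properties using (_<?_)
open import Data.List using (List; []; _∷_; length; filter; concatMap; map; allFin)
open import Data.Empty using (⊥)
open import Relation.Nullary using (Dec)
open import Relation.Nullary.Decidable using (⌊_⌋)
open import Data.Bool using (if_then_else_)
open import Data.List.Relation.Unary.Unique.Propositional using (Unique)
import Data.List.Relation.Unary.Unique.DecPropositional as UDec
open import Data.Integer using (+_)
open import Data.Rational using (ℚ; _/_; 0ℚ; 1ℚ; _+_; _*_)
open import Data.Product using (Σ; _×_; _,_)
open import Relation.Nullary using (yes; no)
open import Relation.Binary.PropositionalEquality using (_≡_)

S : ℕ → ℕ → ℕ
S zero    zero    = 1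
S zero    (suc k) = 0
S (suc n) zero    = 0
S (suc n) (suc k) = suc k ℕ.* S n (suc k) ℕ.+ S n k

-- Permutations of [m] (0-based: Fin m), listed as the lists
-- (σ(1),…,σ(m)) of values; a permutation is a duplicate-free list of
-- length m over Fin m.

allWords : (m n : ℕ) → List (List (Fin n))
allWords zero    n = [] ∷ []
allWords (suc m) n = concatMap (λ w → map (_∷ w) (allFin n)) (allWords m n)

perms : (m : ℕ) → List (List (Fin m))
perms m = filter (UDec.unique? Fin._≟_) (allWords m m)

desFrom : ∀ {m} → Fin m → List (Fin m) → ℕ
desFrom x []       = 0
desFrom x (y ∷ xs) = (if ⌊ y <? x ⌋ then 1 else 0) ℕ.+ desFrom y xs

des : ∀ {m} → List (Fin m) → ℕ
des []       = 0
des (x ∷ xs) = desFrom x xs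

startsWith : ∀ {m} → Fin m → List (Fin m) → Set
startsWith j []      = ⊥
startsWith j (x ∷ _) = x ≡ j

startsWith? : ∀ {m} (j : Fin m) (w : List (Fin m)) → Dec (startsWith j w)
startsWith? j []      = no (λ ())
startsWith? j (x ∷ _) = x Fin.≟ j

-- A(m, i, j+1) : number of σ ∈ S_m with σ(1) = j+1 and des σ = i,
-- where j : Fin m is the 0-based value (so j+1 ranges over 1..m).
A : (m : ℕ) → ℕ → Fin m → ℕ
A m i j = length (filter (λ w → des w ℕ.≟ i) (filter (startsWith? j) (perms m)))

Mat : ℕ → Set
Mat n = Fin n → Fin n → ℚ

ℕ→ℚ : ℕ → ℚ
ℕ→ℚ n = + n / 1

Σ[<] : ∀ {n} → (Fin n → ℚ) → ℚ
Σ[<] {zero}  f = 0ℚ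
Σ[<] {suc n} f = f Fin.zero + Σ[<] (λ i → f (Fin.suc i))

_⊗_ : ∀ {n} → Mat n → Mat n → Mat n
(M ⊗ N) i j = Σ[<] (λ k → M i k * N k j)

I : ∀ {n} → Mat n
I i j with i Fin.≟ j
... | yes _ = 1ℚ
... | no  _ = 0ℚ

diag : ∀ {n} → (Fin n → ℚ) → Mat n
diag v i j with i Fin.≟ j
... | yes _ = v i
... | no  _ = 0ℚ

_≋_ : ∀ {n} → Mat n → Mat n → Set
M ≋ N = ∀ i j → M i j ≡ N i j

Inverse : ∀ {n} → Mat n → Mat n → Set
Inverse P Q = ((P ⊗ Q) ≋ I) × ((Q ⊗ P) ≋ I)

Similar : ∀ {n} → Mat n → Mat n → Set
Similar {n} M N = Σ (Mat n) λ P → Σ (Mat n) λ Q → Inverse P Q × ((Q ⊗ (M ⊗ P)) ≋ N)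

-- The matrices 𝔉_{d-1} and ℌ_{d-1}, of size (d+1) × (d+1), indices 0..d.

𝔉 : (d : ℕ) → Mat (suc d)
𝔉 d i j = ℕ→ℚ ((toℕ i) ! ℕ.* S (toℕ j) (toℕ i))

ℌ : (d : ℕ) → Mat (suc d)
ℌ d i j = ℕ→ℚ (A (suc d) (toℕ i) j)

eigs : (d : ℕ) → Fin (suc d) → ℚ
eigs d Fin.zero    = 1ℚ
eigs d (Fin.suc k) = ℕ→ℚ (toℕ (Fin.suc k) !)

module Submission where

open import Defs
open import Data.Nat using (ℕ; suc; _≤_)
open import Data.Product using (_×_; _,_)

-- 𝔉 is upper triangular with diagonal 0!, 1!, 2!, …, d!. The only repeated diagonal entry is 1, in
-- rows 0 and 1, and row 0 of 𝔉 is (1, 0, …, 0); so no Jordan block can form and 𝔉 is similar to its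
-- diagonal. For ℌ we show 𝔉 𝔗 = 𝔗 ℌ, where 𝔗 is the lower unitriangular matrix of binomial
-- coefficients C(d − i, k − i). Deleting the first letter of a permutation gives a recurrence in d
-- for the numbers A(d + 1, i, j), hence for 𝔗 ℌ; Pascal's rule and Σᵢ C(n, i) S(i, k) = S(n + 1, k + 1)
-- show that 𝔉 𝔗 satisfies the same recurrence.

module Embedding where

  import Data.Nat as ℕ
  import Data.Nat.Properties as ℕ
  open import Data.Integer using (+_)
  import Data.Integer.Properties as ℤ
  open import Data.Rational using (mkℚ; ↥_; _+_; _*_)
  open import Data.Rational.Properties using (normalize-coprime)
  open import Data.Nat.Coprimality using (1-coprimeTo) renaming (sym to coprime-sym)
  open import Relation.Binary.PropositionalEquality

  ℕ→ℚ≡mkℚ : ∀ n → ℕ→ℚ n ≡ mkℚ (+ n) 0 (coprime-sym (1-coprimeTo n))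
  ℕ→ℚ≡mkℚ n = normalize-coprime (coprime-sym (1-coprimeTo n))

  ℕ→ℚ-+ : ∀ a b → ℕ→ℚ (a ℕ.+ b) ≡ ℕ→ℚ a + ℕ→ℚ b
  ℕ→ℚ-+ a b rewrite ℕ→ℚ≡mkℚ a | ℕ→ℚ≡mkℚ b | ℕ.*-identityʳ a | ℕ.*-identityʳ b
    | ℤ.+◃n≡+n a | ℤ.+◃n≡+n b = refl

  ℕ→ℚ-* : ∀ a b → ℕ→ℚ (a ℕ.* b) ≡ ℕ→ℚ a * ℕ→ℚ b
  ℕ→ℚ-* a b rewrite ℕ→ℚ≡mkℚ a | ℕ→ℚ≡mkℚ b | ℤ.+◃n≡+n (a ℕ.* b) = refl

  ℕ→ℚ-injective : ∀ {a b} → ℕ→ℚ a ≡ ℕ→ℚ b → a ≡ b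
  ℕ→ℚ-injective {a} {b} e = ℤ.+-injective (cong ↥_ (trans (sym (ℕ→ℚ≡mkℚ a)) (trans e (ℕ→ℚ≡mkℚ b))))

module Matrices where

  open import Data.Nat using (ℕ; zero; suc)
  open import Data.Fin using (Fin; zero; suc; _≟_)
  open import Data.Rational using (ℚ; 0ℚ; 1ℚ; _+_; _*_; -_)
  open import Data.Rational.Properties
    using (+-*-commutativeRing; +-identityˡ; +-identityʳ; *-identityˡ; *-zeroˡ; *-comm; *-assoc; neg-distrib-+)
  open import Algebra.Bundles using (CommutativeRing)
  open import Algebra.Properties.Semiring.Sum (CommutativeRing.semiring +-*-commutativeRing)
    using (sum; ∑-comm; *-distribˡ-sum; *-distribʳ-sum)
  open import Data.Product using (_,_)
  open import Relation.Nullary using (yes; no)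
  open import Relation.Binary.Bundles using (Setoid)
  open import Relation.Binary.PropositionalEquality
  import Relation.Binary.Reasoning.Setoid as SetoidReasoning

  Σ[<]≡sum : ∀ {n} (f : Fin n → ℚ) → Σ[<] f ≡ sum f
  Σ[<]≡sum {zero}  f = refl
  Σ[<]≡sum {suc n} f = cong (f zero +_) (Σ[<]≡sum (λ i → f (suc i)))

  Σ[<]-cong : ∀ {n} {f g : Fin n → ℚ} → (∀ i → f i ≡ g i) → Σ[<] f ≡ Σ[<] g
  Σ[<]-cong {zero}  f≗g = refl
  Σ[<]-cong {suc n} f≗g = cong₂ _+_ (f≗g zero) (Σ[<]-cong (λ i → f≗g (suc i)))

  Σ[<]-zero : ∀ {n} {f : Fin n → ℚ} → (∀ i → f i ≡ 0ℚ) → Σ[<] f ≡ 0ℚ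
  Σ[<]-zero {zero}  f≗0 = refl
  Σ[<]-zero {suc n} f≗0 = trans (cong₂ _+_ (f≗0 zero) (Σ[<]-zero (λ i → f≗0 (suc i)))) (+-identityˡ 0ℚ)

  Σ[<]-neg : ∀ {n} (f : Fin n → ℚ) → Σ[<] (λ i → - f i) ≡ - Σ[<] f
  Σ[<]-neg {zero}  f = refl
  Σ[<]-neg {suc n} f =
    trans (cong (- f zero +_) (Σ[<]-neg (λ i → f (suc i)))) (sym (neg-distrib-+ (f zero) _))

  Σ[<]-comm : ∀ {m n} (f : Fin m → Fin n → ℚ) →
    Σ[<] (λ i → Σ[<] (λ j → f i j)) ≡ Σ[<] (λ j → Σ[<] (λ i → f i j))
  Σ[<]-comm f = begin
    Σ[<] (λ i → Σ[<] (λ j → f i j)) ≡⟨ trans (Σ[<]-cong (λ i → Σ[<]≡sum (f i))) (Σ[<]≡sum (λ i → sum (f i))) ⟩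
    sum (λ i → sum (λ j → f i j))     ≡⟨ ∑-comm f ⟩
    sum (λ j → sum (λ i → f i j))
      ≡⟨ sym (trans (Σ[<]-cong (λ j → Σ[<]≡sum (λ i → f i j))) (Σ[<]≡sum (λ j → sum (λ i → f i j)))) ⟩
    Σ[<] (λ j → Σ[<] (λ i → f i j)) ∎
    where open ≡-Reasoning

  *-distribˡ-Σ[<] : ∀ {n} c (f : Fin n → ℚ) → c * Σ[<] f ≡ Σ[<] (λ i → c * f i)
  *-distribˡ-Σ[<] c f = trans (cong (c *_) (Σ[<]≡sum f))
    (trans (*-distribˡ-sum c f) (sym (Σ[<]≡sum (λ i → c * f i))))

  *-distribʳ-Σ[<] : ∀ {n} c (f : Fin n → ℚ) → Σ[<] f * c ≡ Σ[<] (λ i → f i * c)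
  *-distribʳ-Σ[<] c f = trans (cong (_* c) (Σ[<]≡sum f))
    (trans (*-distribʳ-sum c f) (sym (Σ[<]≡sum (λ i → f i * c))))

  I-suc : ∀ {n} (i j : Fin n) → I (suc i) (suc j) ≡ I i j
  I-suc i j with i ≟ j
  ... | yes _ = refl
  ... | no  _ = refl

  diag-suc : ∀ {n} (v : Fin (suc n) → ℚ) (i j : Fin n) →
    diag v (suc i) (suc j) ≡ diag (λ k → v (suc k)) i j
  diag-suc v i j with i ≟ j
  ... | yes _ = refl
  ... | no  _ = refl

  I-sym : ∀ {n} (i j : Fin n) → I i j ≡ I j i
  I-sym zero    zero    = refl
  I-sym zero    (suc j) = refl
  I-sym (suc i) zero    = refl
  I-sym (suc i) (suc j) = trans (I-suc i j) (trans (I-sym i j) (sym (I-suc j i)))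

  diag≡I* : ∀ {n} (v : Fin n → ℚ) (i j : Fin n) → diag v i j ≡ I i j * v j
  diag≡I* v i j with i ≟ j
  ... | yes refl = sym (*-identityˡ (v i))
  ... | no  _    = sym (*-zeroˡ (v j))

  Σ[<]-Iˡ : ∀ {n} (i : Fin n) (f : Fin n → ℚ) → Σ[<] (λ k → I i k * f k) ≡ f i
  Σ[<]-Iˡ {suc n} zero f = begin
    1ℚ * f zero + Σ[<] (λ k → 0ℚ * f (suc k))
      ≡⟨ cong₂ _+_ (*-identityˡ (f zero)) (Σ[<]-zero (λ k → *-zeroˡ (f (suc k)))) ⟩
    f zero + 0ℚ ≡⟨ +-identityʳ (f zero) ⟩
    f zero ∎
    where open ≡-Reasoning
  Σ[<]-Iˡ {suc n} (suc i) f = begin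
    0ℚ * f zero + Σ[<] (λ k → I (suc i) (suc k) * f (suc k))
      ≡⟨ cong₂ _+_ (*-zeroˡ (f zero)) (Σ[<]-cong (λ k → cong (_* f (suc k)) (I-suc i k))) ⟩
    0ℚ + Σ[<] (λ k → I i k * f (suc k)) ≡⟨ +-identityˡ _ ⟩
    Σ[<] (λ k → I i k * f (suc k))       ≡⟨ Σ[<]-Iˡ i (λ k → f (suc k)) ⟩
    f (suc i) ∎
    where open ≡-Reasoning

  Σ[<]-Iʳ : ∀ {n} (j : Fin n) (f : Fin n → ℚ) → Σ[<] (λ k → f k * I k j) ≡ f j
  Σ[<]-Iʳ j f = trans (Σ[<]-cong (λ k → trans (*-comm (f k) _) (cong (_* f k) (I-sym k j)))) (Σ[<]-Iˡ j f)

  Σ[<]-diagʳ : ∀ {n} (v f : Fin n → ℚ) (j : Fin n) → Σ[<] (λ k → f k * diag v k j) ≡ f j * v j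
  Σ[<]-diagʳ v f j = begin
    Σ[<] (λ k → f k * diag v k j)  ≡⟨ Σ[<]-cong (λ k → trans (cong (f k *_) (diag≡I* v k j)) (sym (*-assoc (f k) _ _))) ⟩
    Σ[<] (λ k → f k * I k j * v j) ≡⟨ sym (*-distribʳ-Σ[<] (v j) (λ k → f k * I k j)) ⟩
    Σ[<] (λ k → f k * I k j) * v j ≡⟨ cong (_* v j) (Σ[<]-Iʳ j f) ⟩
    f j * v j ∎
    where open ≡-Reasoning

  ≋-sym : ∀ {n} {A B : Mat n} → A ≋ B → B ≋ A
  ≋-sym A≋B i j = sym (A≋B i j)

  ≋-trans : ∀ {n} {A B C : Mat n} → A ≋ B → B ≋ C → A ≋ C
  ≋-trans A≋B B≋C i j = trans (A≋B i j) (B≋C i j)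

  ≋-setoid : ℕ → Setoid _ _
  ≋-setoid n = record
    { Carrier = Mat n
    ; _≈_ = _≋_
    ; isEquivalence = record
      { refl  = λ i j → refl
      ; sym   = ≋-sym
      ; trans = ≋-trans
      }
    }

  module ≋-Reasoning {n} = SetoidReasoning (≋-setoid n)

  ⊗-congˡ : ∀ {n} (A : Mat n) {B B′ : Mat n} → B ≋ B′ → (A ⊗ B) ≋ (A ⊗ B′)
  ⊗-congˡ A B≋B′ i j = Σ[<]-cong (λ k → cong (A i k *_) (B≋B′ k j))

  ⊗-congʳ : ∀ {n} {A A′ : Mat n} (B : Mat n) → A ≋ A′ → (A ⊗ B) ≋ (A′ ⊗ B)
  ⊗-congʳ B A≋A′ i j = Σ[<]-cong (λ k → cong (_* B k j) (A≋A′ i k))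

  ⊗-identityˡ : ∀ {n} (M : Mat n) → (I ⊗ M) ≋ M
  ⊗-identityˡ M i j = Σ[<]-Iˡ i (λ k → M k j)

  ⊗-identityʳ : ∀ {n} (M : Mat n) → (M ⊗ I) ≋ M
  ⊗-identityʳ M i j = Σ[<]-Iʳ j (M i)

  ⊗-assoc : ∀ {n} (A B C : Mat n) → ((A ⊗ B) ⊗ C) ≋ (A ⊗ (B ⊗ C))
  ⊗-assoc {n} A B C i j = begin
    Σ[<] (λ k → Σ[<] (λ l → A i l * B l k) * C k j)
      ≡⟨ Σ[<]-cong (λ k → trans (*-distribʳ-Σ[<] {n} (C k j) (λ l → A i l * B l k))
                                (Σ[<]-cong (λ l → *-assoc (A i l) (B l k) (C k j)))) ⟩
    Σ[<] (λ k → Σ[<] (λ l → A i l * (B l k * C k j)))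
      ≡⟨ Σ[<]-comm (λ k l → A i l * (B l k * C k j)) ⟩
    Σ[<] (λ l → Σ[<] (λ k → A i l * (B l k * C k j)))
      ≡⟨ Σ[<]-cong (λ l → sym (*-distribˡ-Σ[<] (A i l) (λ k → B l k * C k j))) ⟩
    Σ[<] (λ l → A i l * Σ[<] (λ k → B l k * C k j)) ∎
    where open ≡-Reasoning

  Inverse-respˡ : ∀ {n} {L L′ Q : Mat n} → L ≋ L′ → Inverse L′ Q → Inverse L Q
  Inverse-respˡ {Q = Q} L≋L′ (L′Q≋I , QL′≋I) =
    ≋-trans (⊗-congʳ Q L≋L′) L′Q≋I , ≋-trans (⊗-congˡ Q L≋L′) QL′≋I

  Similar-sym : ∀ {n} {M N : Mat n} → Similar M N → Similar N M
  Similar-sym {M = M} {N} (P , Q , (PQ≋I , QP≋I) , QMP≋N) = Q , P , (QP≋I , PQ≋I) , PNQ≋M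
    where
    open ≋-Reasoning
    PNQ≋M : (P ⊗ (N ⊗ Q)) ≋ M
    PNQ≋M = begin
      P ⊗ (N ⊗ Q)               ≈⟨ ⊗-congˡ P (⊗-congʳ Q QMP≋N) ⟨
      P ⊗ ((Q ⊗ (M ⊗ P)) ⊗ Q)   ≈⟨ ⊗-congˡ P (⊗-assoc Q (M ⊗ P) Q) ⟩
      P ⊗ (Q ⊗ ((M ⊗ P) ⊗ Q))   ≈⟨ ⊗-assoc P Q _ ⟨
      (P ⊗ Q) ⊗ ((M ⊗ P) ⊗ Q)   ≈⟨ ⊗-congʳ _ PQ≋I ⟩
      I ⊗ ((M ⊗ P) ⊗ Q)         ≈⟨ ⊗-identityˡ _ ⟩
      (M ⊗ P) ⊗ Q               ≈⟨ ⊗-assoc M P Q ⟩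
      M ⊗ (P ⊗ Q)               ≈⟨ ⊗-congˡ M PQ≋I ⟩
      M ⊗ I                     ≈⟨ ⊗-identityʳ M ⟩
      M ∎

  Inverse-⊗ : ∀ {n} {P Q P′ Q′ : Mat n} → Inverse P Q → Inverse P′ Q′ → Inverse (P ⊗ P′) (Q′ ⊗ Q)
  Inverse-⊗ {P = P} {Q} {P′} {Q′} (PQ≋I , QP≋I) (P′Q′≋I , Q′P′≋I) =
    cancel P P′ Q′ Q P′Q′≋I PQ≋I , cancel Q′ Q P P′ QP≋I Q′P′≋I
    where
    cancel : ∀ A B C D → (B ⊗ C) ≋ I → (A ⊗ D) ≋ I → ((A ⊗ B) ⊗ (C ⊗ D)) ≋ I
    cancel A B C D BC≋I AD≋I = begin
      (A ⊗ B) ⊗ (C ⊗ D) ≈⟨ ⊗-assoc A B _ ⟩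
      A ⊗ (B ⊗ (C ⊗ D)) ≈⟨ ⊗-congˡ A (⊗-assoc B C D) ⟨
      A ⊗ ((B ⊗ C) ⊗ D) ≈⟨ ⊗-congˡ A (⊗-congʳ D BC≋I) ⟩
      A ⊗ (I ⊗ D)       ≈⟨ ⊗-congˡ A (⊗-identityˡ D) ⟩
      A ⊗ D             ≈⟨ AD≋I ⟩
      I ∎
      where open ≋-Reasoning

  Similar-trans : ∀ {n} {M N K : Mat n} → Similar M N → Similar N K → Similar M K
  Similar-trans {M = M} {N} {K} (P , Q , PQ , QMP≋N) (P′ , Q′ , P′Q′ , Q′NP′≋K) =
    P ⊗ P′ , Q′ ⊗ Q , Inverse-⊗ {P = P} {Q} {P′} {Q′} PQ P′Q′ , conj
    where
    open ≋-Reasoning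
    conj : ((Q′ ⊗ Q) ⊗ (M ⊗ (P ⊗ P′))) ≋ K
    conj = begin
      (Q′ ⊗ Q) ⊗ (M ⊗ (P ⊗ P′))   ≈⟨ ⊗-assoc Q′ Q _ ⟩
      Q′ ⊗ (Q ⊗ (M ⊗ (P ⊗ P′)))   ≈⟨ ⊗-congˡ Q′ (⊗-congˡ Q (⊗-assoc M P P′)) ⟨
      Q′ ⊗ (Q ⊗ ((M ⊗ P) ⊗ P′))   ≈⟨ ⊗-congˡ Q′ (⊗-assoc Q (M ⊗ P) P′) ⟨
      Q′ ⊗ ((Q ⊗ (M ⊗ P)) ⊗ P′)   ≈⟨ ⊗-congˡ Q′ (⊗-congʳ P′ QMP≋N) ⟩
      Q′ ⊗ (N ⊗ P′)               ≈⟨ Q′NP′≋K ⟩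
      K ∎

  Similar-respˡ : ∀ {n} {M M′ N : Mat n} → M ≋ M′ → Similar M′ N → Similar M N
  Similar-respˡ M≋M′ (P , Q , PQ , QM′P≋N) = P , Q , PQ , ≋-trans (⊗-congˡ Q (⊗-congʳ P M≋M′)) QM′P≋N

  Similar-respʳ : ∀ {n} {M N N′ : Mat n} → N ≋ N′ → Similar M N → Similar M N′
  Similar-respʳ N≋N′ (P , Q , PQ , QMP≋N) = P , Q , PQ , λ i j → trans (QMP≋N i j) (N≋N′ i j)

  intertwining⇒Similar : ∀ {n} {M N P Q : Mat n} → Inverse P Q → (M ⊗ P) ≋ (P ⊗ N) → Similar M N
  intertwining⇒Similar {M = M} {N} {P} {Q} (PQ≋I , QP≋I) MP≋PN = P , Q , (PQ≋I , QP≋I) , conj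
    where
    open ≋-Reasoning
    conj : (Q ⊗ (M ⊗ P)) ≋ N
    conj = begin
      Q ⊗ (M ⊗ P) ≈⟨ ⊗-congˡ Q MP≋PN ⟩
      Q ⊗ (P ⊗ N) ≈⟨ ⊗-assoc Q P N ⟨
      (Q ⊗ P) ⊗ N ≈⟨ ⊗-congʳ N QP≋I ⟩
      I ⊗ N       ≈⟨ ⊗-identityˡ N ⟩
      N ∎

  Similar⇒intertwining : ∀ {n} {M N : Mat n} ((P , Q , _) : Similar M N) → (M ⊗ P) ≋ (P ⊗ N)
  Similar⇒intertwining {M = M} {N} (P , Q , (PQ≋I , _) , QMP≋N) = begin
    M ⊗ P             ≈⟨ ⊗-identityˡ (M ⊗ P) ⟨
    I ⊗ (M ⊗ P)       ≈⟨ ⊗-congʳ _ PQ≋I ⟨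
    (P ⊗ Q) ⊗ (M ⊗ P) ≈⟨ ⊗-assoc P Q _ ⟩
    P ⊗ (Q ⊗ (M ⊗ P)) ≈⟨ ⊗-congˡ P QMP≋N ⟩
    P ⊗ N ∎
    where open ≋-Reasoning

module Triangular where

  open Matrices

  open import Data.Nat as ℕ using (zero; suc; z≤n; s≤s)
  open import Data.Fin using (Fin; zero; suc; toℕ)
  open import Data.Rational using (ℚ; 0ℚ; 1ℚ; _+_; _*_; -_; _-_; NonZero; ≢-nonZero; 1/_)
  open import Data.Rational.Properties
    using (+-*-commutativeRing; +-identityˡ; +-identityʳ; *-identityˡ; *-identityʳ; *-zeroˡ; *-zeroʳ;
           +-inverseˡ; +-inverseʳ; *-inverseˡ; neg-distribʳ-*; +-0-group; _≟_; +-comm)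
  open import Relation.Nullary.Decidable using (dec⇒maybe)
  open import Algebra.Properties.Group +-0-group using (x∙y⁻¹≈ε⇒x≈y)
  open import Data.Product using (Σ; ∃; _×_; _,_; proj₁; proj₂; map₂)
  open import Data.Sum using (_⊎_; inj₁; inj₂)
  open import Relation.Binary.PropositionalEquality
  open import Tactic.RingSolver using (solve-∀)
  open import Tactic.RingSolver.Core.AlmostCommutativeRing using (AlmostCommutativeRing; fromCommutativeRing)

  ℚ-ring : AlmostCommutativeRing _ _
  ℚ-ring = fromCommutativeRing +-*-commutativeRing (λ x → dec⇒maybe (0ℚ ≟ x))

  block : ∀ {n} → ℚ → (Fin n → ℚ) → (Fin n → ℚ) → Mat n → Mat (suc n)
  block a r c A zero    zero    = a
  block a r c A zero    (suc j) = r j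
  block a r c A (suc i) zero    = c i
  block a r c A (suc i) (suc j) = A i j

  block-cong : ∀ {n} {a a′ r r′ c c′} {A A′ : Mat n} → a ≡ a′ → (∀ j → r j ≡ r′ j) →
    (∀ i → c i ≡ c′ i) → A ≋ A′ → block a r c A ≋ block a′ r′ c′ A′
  block-cong a≡a′ r≗r′ c≗c′ A≋A′ zero    zero    = a≡a′
  block-cong a≡a′ r≗r′ c≗c′ A≋A′ zero    (suc j) = r≗r′ j
  block-cong a≡a′ r≗r′ c≗c′ A≋A′ (suc i) zero    = c≗c′ i
  block-cong a≡a′ r≗r′ c≗c′ A≋A′ (suc i) (suc j) = A≋A′ i j

  block-η : ∀ {n} (M : Mat (suc n)) →
    M ≋ block (M zero zero) (λ j → M zero (suc j)) (λ i → M (suc i) zero) (λ i j → M (suc i) (suc j))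
  block-η M zero    zero    = refl
  block-η M zero    (suc j) = refl
  block-η M (suc i) zero    = refl
  block-η M (suc i) (suc j) = refl

  0⃗ : ∀ {n} → Fin n → ℚ
  0⃗ _ = 0ℚ

  block-I : ∀ {n} → block 1ℚ 0⃗ 0⃗ (I {n}) ≋ I
  block-I zero    zero    = refl
  block-I zero    (suc j) = refl
  block-I (suc i) zero    = refl
  block-I (suc i) (suc j) = sym (I-suc i j)

  block-diag : ∀ {n} (v : Fin (suc n) → ℚ) → block (v zero) 0⃗ 0⃗ (diag (λ k → v (suc k))) ≋ diag v
  block-diag v zero    zero    = refl
  block-diag v zero    (suc j) = refl
  block-diag v (suc i) zero    = refl
  block-diag v (suc i) (suc j) = sym (diag-suc v i j)

  block-⊗ : ∀ {n} a r c (A : Mat n) b s d B →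
    (block a r c A ⊗ block b s d B) ≋
    block (a * b + Σ[<] (λ k → r k * d k)) (λ j → a * s j + Σ[<] (λ k → r k * B k j))
          (λ i → c i * b + Σ[<] (λ k → A i k * d k)) (λ i j → c i * s j + (A ⊗ B) i j)
  block-⊗ a r c A b s d B zero    zero    = refl
  block-⊗ a r c A b s d B zero    (suc j) = refl
  block-⊗ a r c A b s d B (suc i) zero    = refl
  block-⊗ a r c A b s d B (suc i) (suc j) = refl

  block-⊗-upper : ∀ {n} a r (A : Mat n) b s B →
    (block a r 0⃗ A ⊗ block b s 0⃗ B) ≋
    block (a * b) (λ j → a * s j + Σ[<] (λ k → r k * B k j)) 0⃗ (A ⊗ B)
  block-⊗-upper a r A b s B = ≋-trans (block-⊗ a r 0⃗ A b s 0⃗ B) (block-cong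
    (trans (cong (a * b +_) (Σ[<]-zero (λ k → *-zeroʳ (r k)))) (+-identityʳ (a * b)))
    (λ j → refl)
    (λ i → trans (cong₂ _+_ (*-zeroˡ b) (Σ[<]-zero (λ k → *-zeroʳ (A i k)))) (+-identityˡ 0ℚ))
    (λ i j → trans (cong (_+ (A ⊗ B) i j) (*-zeroˡ (s j))) (+-identityˡ _)))

  block-⊗-lower : ∀ {n} a c (A : Mat n) b d B →
    (block a 0⃗ c A ⊗ block b 0⃗ d B) ≋
    block (a * b) 0⃗ (λ i → c i * b + Σ[<] (λ k → A i k * d k)) (A ⊗ B)
  block-⊗-lower a c A b d B = ≋-trans (block-⊗ a 0⃗ c A b 0⃗ d B) (block-cong
    (trans (cong (a * b +_) (Σ[<]-zero (λ k → *-zeroˡ (d k)))) (+-identityʳ (a * b)))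
    (λ j → trans (cong₂ _+_ (*-zeroʳ a) (Σ[<]-zero (λ k → *-zeroˡ (B k j)))) (+-identityˡ 0ℚ))
    (λ i → refl)
    (λ i j → trans (cong (_+ (A ⊗ B) i j) (*-zeroʳ (c i))) (+-identityˡ _)))

  -- every column of A ⊗ column c is the vector A c
  column : ∀ {n} → (Fin n → ℚ) → Mat n
  column c i _ = c i

  block-lower-invertible : ∀ {n} (c : Fin n → ℚ) {L Q : Mat n} → Inverse L Q →
    Σ (Mat (suc n)) (Inverse (block 1ℚ 0⃗ c L))
  block-lower-invertible {n} c {L} {Q} (LQ≋I , QL≋I) = block 1ℚ 0⃗ w Q ,
    ≋-trans (block-⊗-lower 1ℚ c L 1ℚ w Q) (≋-trans (block-cong refl (λ _ → refl) c-cancel LQ≋I) block-I) ,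
    ≋-trans (block-⊗-lower 1ℚ w Q 1ℚ c L) (≋-trans (block-cong refl (λ _ → refl) w-cancel QL≋I) block-I)
    where
    w : Fin n → ℚ
    w i = - (Q ⊗ column c) i i
    LQc≡c : ∀ i → Σ[<] (λ k → L i k * (Q ⊗ column c) k k) ≡ c i
    LQc≡c i = trans (sym (⊗-assoc L Q (column c) i i))
      (trans (⊗-congʳ (column c) LQ≋I i i) (⊗-identityˡ (column c) i i))
    c-cancel : ∀ i → c i * 1ℚ + Σ[<] (λ k → L i k * w k) ≡ 0ℚ
    c-cancel i = begin
      c i * 1ℚ + Σ[<] (λ k → L i k * w k)
        ≡⟨ cong₂ _+_ (*-identityʳ (c i)) (Σ[<]-cong (λ k → sym (neg-distribʳ-* (L i k) _))) ⟩
      c i + Σ[<] (λ k → - (L i k * (Q ⊗ column c) k k))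
        ≡⟨ cong (c i +_) (trans (Σ[<]-neg (λ k → L i k * (Q ⊗ column c) k k)) (cong -_ (LQc≡c i))) ⟩
      c i - c i ≡⟨ +-inverseʳ (c i) ⟩
      0ℚ ∎
      where open ≡-Reasoning
    w-cancel : ∀ i → w i * 1ℚ + Σ[<] (λ k → Q i k * c k) ≡ 0ℚ
    w-cancel i = trans (cong (_+ Σ[<] (λ k → Q i k * c k)) (*-identityʳ (w i))) (+-inverseˡ (Σ[<] (λ k → Q i k * c k)))

  LowerUnitriangular : ∀ {n} → Mat n → Set
  LowerUnitriangular M = (∀ i j → toℕ i ℕ.< toℕ j → M i j ≡ 0ℚ) × (∀ i → M i i ≡ 1ℚ)

  lowerUnitriangular-invertible : ∀ {n} (L : Mat n) → LowerUnitriangular L → Σ (Mat n) (Inverse L)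
  lowerUnitriangular-invertible {zero}  L _ = (λ ()) , (λ ()) , (λ ())
  lowerUnitriangular-invertible {suc n} L (above≡0 , diag≡1)
    with lowerUnitriangular-invertible L′ ((λ i j i<j → above≡0 (suc i) (suc j) (s≤s i<j)) , (λ i → diag≡1 (suc i)))
    where
    L′ : Mat n
    L′ i j = L (suc i) (suc j)
  ... | _ , L′Q = map₂ (λ {Q} → Inverse-respˡ {Q = Q} L≋block) (block-lower-invertible c L′Q)
    where
    c : Fin n → ℚ
    c i = L (suc i) zero
    L≋block : L ≋ block 1ℚ 0⃗ c (λ i j → L (suc i) (suc j))
    L≋block = ≋-trans (block-η L)
      (block-cong (diag≡1 zero) (λ j → above≡0 zero (suc j) (s≤s z≤n)) (λ _ → refl) (λ _ _ → refl))

  block-1-inverse : ∀ {n} {P Q : Mat n} → Inverse P Q → Inverse (block 1ℚ 0⃗ 0⃗ P) (block 1ℚ 0⃗ 0⃗ Q)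
  block-1-inverse {P = P} {Q} (PQ≋I , QP≋I) = cancel P Q PQ≋I , cancel Q P QP≋I
    where
    cancel : ∀ A B → (A ⊗ B) ≋ I → (block 1ℚ 0⃗ 0⃗ A ⊗ block 1ℚ 0⃗ 0⃗ B) ≋ I
    cancel A B AB≋I = ≋-trans (block-⊗-upper 1ℚ 0⃗ A 1ℚ 0⃗ B)
      (≋-trans (block-cong refl
                  (λ j → trans (cong₂ _+_ (*-zeroʳ 1ℚ) (Σ[<]-zero (λ k → *-zeroˡ (B k j)))) (+-identityˡ 0ℚ))
                  (λ _ → refl) AB≋I)
        block-I)

  block-similar : ∀ {n} a r {M N P Q : Mat n} → Inverse P Q → (M ⊗ P) ≋ (P ⊗ N) →
    Similar (block a r 0⃗ M) (block a (λ j → Σ[<] (λ k → r k * P k j)) 0⃗ N)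
  block-similar a r {M} {N} {P} {Q} PQ MP≋PN =
    intertwining⇒Similar {M = block a r 0⃗ M} {block a rP 0⃗ N} {block 1ℚ 0⃗ 0⃗ P} {block 1ℚ 0⃗ 0⃗ Q}
      (block-1-inverse PQ)
    (≋-trans (block-⊗-upper a r M 1ℚ 0⃗ P)
      (≋-trans (block-cong (trans (*-identityʳ a) (sym (*-identityˡ a))) rP-entry (λ _ → refl) MP≋PN)
        (≋-sym (block-⊗-upper 1ℚ 0⃗ P a rP N))))
    where
    rP : Fin _ → ℚ
    rP j = Σ[<] (λ k → r k * P k j)
    rP-entry : ∀ j → a * 0ℚ + rP j ≡ 1ℚ * rP j + Σ[<] (λ k → 0ℚ * N k j)
    rP-entry j = begin
      a * 0ℚ + rP j ≡⟨ cong (_+ rP j) (*-zeroʳ a) ⟩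
      0ℚ + rP j     ≡⟨ +-identityˡ (rP j) ⟩
      rP j          ≡⟨ +-identityʳ (rP j) ⟨
      rP j + 0ℚ     ≡⟨ cong₂ _+_ (*-identityˡ (rP j)) (Σ[<]-zero (λ k → *-zeroˡ (N k j))) ⟨
      1ℚ * rP j + Σ[<] (λ k → 0ℚ * N k j) ∎
      where open ≡-Reasoning

  a*x+u≡x*l-solvable : (a u l : ℚ) → l ≢ a ⊎ u ≡ 0ℚ → ∃ λ x → a * x + u ≡ x * l
  a*x+u≡x*l-solvable a u l (inj₂ u≡0) = 0ℚ , trans (cong₂ _+_ (*-zeroʳ a) u≡0) (sym (*-zeroˡ l))
  a*x+u≡x*l-solvable a u l (inj₁ l≢a) = u * 1/ (l - a) , a*x+u≡x*l
    where
    instance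
      l-a≢0 : NonZero (l - a)
      l-a≢0 = ≢-nonZero (λ l-a≡0 → l≢a (x∙y⁻¹≈ε⇒x≈y l a l-a≡0))
    x = u * 1/ (l - a)
    ring-identity : ∀ a u y l → a * (u * y) + u * (y * (l + - a)) ≡ u * y * l
    ring-identity = solve-∀ ℚ-ring
    a*x+u≡x*l : a * x + u ≡ x * l
    a*x+u≡x*l = begin
      a * x + u                           ≡⟨ cong (a * x +_) (sym (*-identityʳ u)) ⟩
      a * x + u * 1ℚ                      ≡⟨ cong (λ t → a * x + u * t) (sym (*-inverseˡ (l - a))) ⟩
      a * x + u * (1/ (l - a) * (l - a))  ≡⟨ ring-identity a u (1/ (l - a)) l ⟩
      x * l ∎
      where open ≡-Reasoning

  unipotent-inverse : ∀ {n} (y z : Fin n → ℚ) → (∀ j → y j + z j ≡ 0ℚ) →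
    (block 1ℚ y 0⃗ I ⊗ block 1ℚ z 0⃗ I) ≋ I
  unipotent-inverse y z y+z≡0 = ≋-trans (block-⊗-upper 1ℚ y I 1ℚ z I)
    (≋-trans (block-cong refl top-row (λ _ → refl) (⊗-identityˡ I)) block-I)
    where
    top-row : ∀ j → 1ℚ * z j + Σ[<] (λ k → y k * I k j) ≡ 0ℚ
    top-row j = trans (cong₂ _+_ (*-identityˡ (z j)) (Σ[<]-Iʳ j y)) (trans (+-comm (z j) (y j)) (y+z≡0 j))

  block-top-row-clearable : ∀ {n} a (u e : Fin n → ℚ) → (∀ k → e k ≢ a ⊎ u k ≡ 0ℚ) →
    Similar (block a u 0⃗ (diag e)) (block a 0⃗ 0⃗ (diag e))
  block-top-row-clearable a u e solvable =
    intertwining⇒Similar {M = block a u 0⃗ (diag e)} {block a 0⃗ 0⃗ (diag e)}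
                         {block 1ℚ x 0⃗ I} {block 1ℚ (λ j → - x j) 0⃗ I}
      (unipotent-inverse x (λ j → - x j) (λ j → +-inverseʳ (x j)) ,
       unipotent-inverse (λ j → - x j) x (λ j → +-inverseˡ (x j)))
      (≋-trans (block-⊗-upper a u (diag e) 1ℚ x I)
        (≋-trans (block-cong (trans (*-identityʳ a) (sym (*-identityˡ a))) top-row (λ _ → refl)
                   (≋-trans (⊗-identityʳ (diag e)) (≋-sym (⊗-identityˡ (diag e)))))
          (≋-sym (block-⊗-upper 1ℚ x I a 0⃗ (diag e)))))
    where
    x : Fin _ → ℚ
    x k = proj₁ (a*x+u≡x*l-solvable a (u k) (e k) (solvable k))
    top-row : ∀ j → a * x j + Σ[<] (λ k → u k * I k j) ≡ 1ℚ * 0ℚ + Σ[<] (λ k → x k * diag e k j)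
    top-row j = begin
      a * x j + Σ[<] (λ k → u k * I k j)      ≡⟨ cong (a * x j +_) (Σ[<]-Iʳ j u) ⟩
      a * x j + u j                           ≡⟨ proj₂ (a*x+u≡x*l-solvable a (u j) (e j) (solvable j)) ⟩
      x j * e j                               ≡⟨ sym (Σ[<]-diagʳ e x j) ⟩
      Σ[<] (λ k → x k * diag e k j)           ≡⟨ sym (+-identityˡ _) ⟩
      1ℚ * 0ℚ + Σ[<] (λ k → x k * diag e k j) ∎
      where open ≡-Reasoning

  UpperTriangular : ∀ {n} → Mat n → Set
  UpperTriangular M = ∀ i j → toℕ j ℕ.< toℕ i → M i j ≡ 0ℚ

  -- Every row either vanishes right of the diagonal or has a diagonal entry that does not
  -- recur further down; this is what rules out nontrivial Jordan blocks.
  Decoupled : ∀ {n} → Mat n → Set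
  Decoupled M = ∀ i → (∀ j → toℕ i ℕ.< toℕ j → M i j ≡ 0ℚ) ⊎ (∀ j → toℕ i ℕ.< toℕ j → M j j ≢ M i i)

  upperTriangular-diagonalisable : ∀ {n} (M : Mat n) → UpperTriangular M → Decoupled M →
    Similar M (diag (λ i → M i i))
  upperTriangular-diagonalisable {zero}  M _ _ = (λ ()) , (λ ()) , ((λ ()) , (λ ())) , (λ ())
  upperTriangular-diagonalisable {suc n} M below≡0 decoupled =
    Similar-respˡ {M = M} {block a r 0⃗ M′} {D} M≋block
      (Similar-trans {M = block a r 0⃗ M′} {block a u 0⃗ (diag e)} {D}
        (block-similar a r {M′} {diag e} {P′} {Q′} P′Q′ (Similar⇒intertwining {M = M′} {diag e} sim′))
        (Similar-respʳ {M = block a u 0⃗ (diag e)} {block a 0⃗ 0⃗ (diag e)} {D} (block-diag (λ i → M i i))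
          (block-top-row-clearable a u e solvable)))
    where
    D : Mat (suc n)
    D = diag (λ i → M i i)
    M′ : Mat n
    M′ i j = M (suc i) (suc j)
    a = M zero zero
    r : Fin n → ℚ
    r j = M zero (suc j)
    e : Fin n → ℚ
    e k = M′ k k
    M≋block : M ≋ block a r 0⃗ M′
    M≋block = ≋-trans (block-η M) (block-cong refl (λ _ → refl) (λ i → below≡0 (suc i) zero (s≤s z≤n)) (λ _ _ → refl))
    decoupled′ : Decoupled M′
    decoupled′ i with decoupled (suc i)
    ... | inj₁ row≡0  = inj₁ (λ j i<j → row≡0 (suc j) (s≤s i<j))
    ... | inj₂ fresh = inj₂ (λ j i<j → fresh (suc j) (s≤s i<j))
    sim′ = upperTriangular-diagonalisable M′ (λ i j j<i → below≡0 (suc i) (suc j) (s≤s j<i)) decoupled′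
    P′ = proj₁ sim′
    Q′ = proj₁ (proj₂ sim′)
    P′Q′ = proj₁ (proj₂ (proj₂ sim′))
    u : Fin n → ℚ
    u j = Σ[<] (λ k → r k * P′ k j)
    solvable : ∀ k → e k ≢ a ⊎ u k ≡ 0ℚ
    solvable k with decoupled zero
    ... | inj₁ row≡0  =
      inj₂ (Σ[<]-zero (λ j → trans (cong (_* P′ j k) (row≡0 (suc j) (s≤s z≤n))) (*-zeroˡ (P′ j k))))
    ... | inj₂ fresh = inj₁ (fresh (suc k) (s≤s z≤n))

module NatSums where

  open import Data.Nat as ℕ using (ℕ; zero; suc; _+_; _*_; _<ᵇ_; _<_; z≤n; s≤s)
  import Data.Nat.Properties as ℕ
  open import Algebra.Properties.Semiring.Sum ℕ.+-*-semiring
    using (sum; sum-syntax; sum-cong-≗; sum-remove; sum-replicate-zero; sum-init-last)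
  open import Data.Fin as Fin using (Fin; zero; suc; toℕ; punchIn; inject₁; fromℕ)
  open import Data.Fin.Properties using (punchInᵢ≢i; toℕ-inject₁; toℕ-fromℕ)
  open import Data.Bool using (not; if_then_else_)
  open import Relation.Nullary using (does)
  open import Relation.Nullary.Decidable using (dec-true; dec-false)
  open import Function using (_∘_)
  open import Relation.Binary.PropositionalEquality
  open ≡-Reasoning

  sum-zero : ∀ {n} {f : Fin n → ℕ} → (∀ i → f i ≡ 0) → sum f ≡ 0
  sum-zero {n} f≗0 = trans (sum-cong-≗ f≗0) (sum-replicate-zero n)

  sum-last : ∀ n (f : ℕ → ℕ) → ∑[ i < suc n ] f (toℕ i) ≡ ∑[ i < n ] f (toℕ i) + f n
  sum-last n f = begin
    ∑[ i < suc n ] f (toℕ i)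
      ≡⟨ sum-init-last {n} (f ∘ toℕ) ⟩
    ∑[ i < n ] f (toℕ (inject₁ i)) + f (toℕ (fromℕ n))
      ≡⟨ cong₂ _+_ (sum-cong-≗ {n} (λ i → cong f (toℕ-inject₁ i))) (cong f (toℕ-fromℕ n)) ⟩
    ∑[ i < n ] f (toℕ i) + f n ∎

  sum-at : ∀ {n} (j : Fin (suc n)) (f : Fin (suc n) → ℕ) → (∀ k → f (punchIn j k) ≡ 0) → sum f ≡ f j
  sum-at j f vanishes =
    trans (sum-remove {i = j} f) (trans (cong (f j +_) (sum-zero vanishes)) (ℕ.+-identityʳ (f j)))

  sum-except : ∀ {n} (j : Fin (suc n)) (g : Fin (suc n) → ℕ) →
    sum (λ x → if not (does (j Fin.≟ x)) then g x else 0) ≡ sum (g ∘ punchIn j)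
  sum-except j g = begin
    sum G
      ≡⟨ sum-remove {i = j} G ⟩
    G j + sum (G ∘ punchIn j)
      ≡⟨ cong₂ _+_ (cong (λ b → if not b then g j else 0) (dec-true (j Fin.≟ j) refl))
                   (sum-cong-≗ (λ k → cong (λ b → if not b then g (punchIn j k) else 0)
                                          (dec-false (j Fin.≟ punchIn j k) (punchInᵢ≢i j k ∘ sym)))) ⟩
    sum (g ∘ punchIn j) ∎
    where
    G = λ x → if not (does (j Fin.≟ x)) then g x else 0

  telescope : ∀ n (f x : ℕ → ℕ) → (∀ j → j < n → f j ≡ x j + f (suc j)) →
    ∀ (j : Fin (suc n)) → f (toℕ j) ≡ ∑[ k < n ] (if toℕ k <ᵇ toℕ j then 0 else x (toℕ k)) + f n
  telescope zero    f x f-step zero    = refl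
  telescope (suc n) f x f-step zero    = begin
    f 0
      ≡⟨ f-step 0 (s≤s z≤n) ⟩
    x 0 + f 1
      ≡⟨ cong (x 0 +_) (telescope n (f ∘ suc) (x ∘ suc) (λ j j<n → f-step (suc j) (s≤s j<n)) zero) ⟩
    x 0 + (∑[ k < n ] (if toℕ k <ᵇ 0 then 0 else x (suc (toℕ k))) + f (suc n))
      ≡⟨ ℕ.+-assoc (x 0) _ _ ⟨
    x 0 + ∑[ k < n ] (if toℕ k <ᵇ 0 then 0 else x (suc (toℕ k))) + f (suc n) ∎
  telescope (suc n) f x f-step (suc j) = telescope n (f ∘ suc) (x ∘ suc) (λ j j<n → f-step (suc j) (s≤s j<n)) j

  shift : (ℕ → ℕ) → ℕ → ℕ
  shift f zero    = 0
  shift f (suc i) = f i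

  shift-cong : ∀ {f g : ℕ → ℕ} → (∀ i → f i ≡ g i) → ∀ i → shift f i ≡ shift g i
  shift-cong f≗g zero    = refl
  shift-cong f≗g (suc i) = f≗g i

  shift-* : ∀ (f : ℕ → ℕ) x k → shift f k * x ≡ shift (λ k′ → f k′ * x) k
  shift-* f x zero    = refl
  shift-* f x (suc k) = refl

  sum-shift : ∀ {n} (f : ℕ → Fin n → ℕ) k →
    ∑[ i < n ] shift (λ k′ → f k′ i) k ≡ shift (λ k′ → ∑[ i < n ] f k′ i) k
  sum-shift {n} f zero    = sum-zero {n} (λ _ → refl)
  sum-shift     f (suc k) = refl

module Descents where

  open import Data.Nat as ℕ using (ℕ; zero; suc; _+_; _<ᵇ_; _<_; s≤s)
  import Data.Nat.Properties as ℕ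
  open import Algebra.Properties.Semiring.Sum ℕ.+-*-semiring using (sum; sum-cong-≗; sum-replicate-zero; ∑-distrib-+)
  open import Data.Fin as Fin using (Fin; zero; suc; toℕ; punchIn)
  open import Data.Fin.Properties using (_<?_; punchInᵢ≢i; punchIn-injective)
  open import Data.List using (List; []; _∷_; length; filter; concatMap; map; allFin; tabulate; _++_)
  open import Data.List.Relation.Unary.All using (all?)
  import Data.List.Relation.Unary.Unique.DecPropositional as UniqueDec
  open import Data.Bool using (Bool; true; false; _∧_; not; if_then_else_)
  open import Data.Bool.Properties using (∧-zeroʳ; ∧-identityʳ)
  open import Relation.Nullary using (Dec; does; ¬?)
  open import Relation.Nullary.Decidable using (isYes≗does; dec-true; dec-false; does-⇔)
  open import Function using (_∘_)
  open import Function.Bundles using (mk⇔)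
  open import Relation.Binary.PropositionalEquality
  open ≡-Reasoning

  ⟦_⟧ : Bool → ℕ
  ⟦ b ⟧ = if b then 1 else 0

  open NatSums

  sumMap : ∀ {X : Set} → (X → ℕ) → List X → ℕ
  sumMap f []       = 0
  sumMap f (x ∷ xs) = f x + sumMap f xs

  sumMap-cong : ∀ {X : Set} {f g : X → ℕ} (xs : List X) → (∀ x → f x ≡ g x) → sumMap f xs ≡ sumMap g xs
  sumMap-cong []       f≗g = refl
  sumMap-cong (x ∷ xs) f≗g = cong₂ _+_ (f≗g x) (sumMap-cong xs f≗g)

  sumMap-++ : ∀ {X : Set} (f : X → ℕ) (xs ys : List X) → sumMap f (xs ++ ys) ≡ sumMap f xs + sumMap f ys
  sumMap-++ f []       ys = refl
  sumMap-++ f (x ∷ xs) ys = trans (cong (f x +_) (sumMap-++ f xs ys)) (sym (ℕ.+-assoc (f x) _ _))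

  sumMap-map : ∀ {X Y : Set} (f : Y → ℕ) (g : X → Y) (xs : List X) → sumMap f (map g xs) ≡ sumMap (f ∘ g) xs
  sumMap-map f g []       = refl
  sumMap-map f g (x ∷ xs) = cong (f (g x) +_) (sumMap-map f g xs)

  sumMap-concatMap : ∀ {X Y : Set} (f : Y → ℕ) (g : X → List Y) (xs : List X) →
    sumMap f (concatMap g xs) ≡ sumMap (sumMap f ∘ g) xs
  sumMap-concatMap f g []       = refl
  sumMap-concatMap f g (x ∷ xs) =
    trans (sumMap-++ f (g x) (concatMap g xs)) (cong (sumMap f (g x) +_) (sumMap-concatMap f g xs))

  sumMap-tabulate : ∀ {X : Set} n (f : X → ℕ) (g : Fin n → X) → sumMap f (tabulate g) ≡ sum (f ∘ g)
  sumMap-tabulate zero    f g = refl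
  sumMap-tabulate (suc n) f g = cong (f (g zero) +_) (sumMap-tabulate n f (g ∘ suc))

  sumMap-sum : ∀ {X : Set} {n} (g : X → Fin n → ℕ) (xs : List X) →
    sumMap (λ x → sum (g x)) xs ≡ sum (λ k → sumMap (λ x → g x k) xs)
  sumMap-sum {n = n} g []       = sym (sum-replicate-zero n)
  sumMap-sum         g (x ∷ xs) =
    trans (cong (sum (g x) +_) (sumMap-sum g xs)) (sym (∑-distrib-+ (g x) (λ k → sumMap (λ y → g y k) xs)))

  sumMap-if : ∀ {X : Set} b (f g : X → ℕ) (xs : List X) →
    sumMap (λ x → if b then f x else g x) xs ≡ (if b then sumMap f xs else sumMap g xs)
  sumMap-if true  f g xs = refl
  sumMap-if false f g xs = refl

  sumMap-shift : ∀ {X : Set} (g : X → ℕ → ℕ) (xs : List X) i →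
    sumMap (λ x → shift (g x) i) xs ≡ shift (λ i′ → sumMap (λ x → g x i′) xs) i
  sumMap-shift g []       zero    = refl
  sumMap-shift g (x ∷ xs) zero    = sumMap-shift g xs zero
  sumMap-shift g xs       (suc i) = refl

  length-filter : ∀ {X : Set} {P : X → Set} (P? : ∀ x → Dec (P x)) (xs : List X) →
    length (filter P? xs) ≡ sumMap (λ x → ⟦ does (P? x) ⟧) xs
  length-filter P? []       = refl
  length-filter P? (x ∷ xs) with does (P? x)
  ... | true  = cong suc (length-filter P? xs)
  ... | false = length-filter P? xs

  sumMap-filter : ∀ {X : Set} {P : X → Set} (P? : ∀ x → Dec (P x)) (p : X → Bool) (xs : List X) →
    sumMap (λ x → ⟦ p x ⟧) (filter P? xs) ≡ sumMap (λ x → ⟦ does (P? x) ∧ p x ⟧) xs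
  sumMap-filter P? p []       = refl
  sumMap-filter P? p (x ∷ xs) with does (P? x)
  ... | true  = cong (⟦ p x ⟧ +_) (sumMap-filter P? p xs)
  ... | false = sumMap-filter P? p xs

  sumMap-allWords-suc : ∀ m n (h : List (Fin n) → ℕ) →
    sumMap h (allWords (suc m) n) ≡ sumMap (λ w → sum (λ x → h (x ∷ w))) (allWords m n)
  sumMap-allWords-suc m n h = trans (sumMap-concatMap h _ (allWords m n))
    (sumMap-cong (allWords m n) (λ w → trans (sumMap-map h (_∷ w) (allFin n))
                                              (sumMap-tabulate n (λ x → h (x ∷ w)) (λ x → x))))

  distinct : ∀ {n} → List (Fin n) → Bool
  distinct w = does (UniqueDec.unique? Fin._≟_ w)

  avoids : ∀ {n} → Fin n → List (Fin n) → Bool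
  avoids j w = does (all? (λ y → ¬? (j Fin.≟ y)) w)

  A-count : ∀ m i (j : Fin m) →
    A m i j ≡ sumMap (λ w → ⟦ distinct w ∧ (does (startsWith? j w) ∧ does (des w ℕ.≟ i)) ⟧) (allWords m m)
  A-count m i j = begin
    length (filter (λ w → des w ℕ.≟ i) (filter (startsWith? j) (perms m)))
      ≡⟨ length-filter (λ w → des w ℕ.≟ i) (filter (startsWith? j) (perms m)) ⟩
    sumMap (λ w → ⟦ does (des w ℕ.≟ i) ⟧) (filter (startsWith? j) (perms m))
      ≡⟨ sumMap-filter (startsWith? j) (λ w → does (des w ℕ.≟ i)) (perms m) ⟩
    sumMap (λ w → ⟦ does (startsWith? j w) ∧ does (des w ℕ.≟ i) ⟧) (perms m)
      ≡⟨ sumMap-filter (UniqueDec.unique? Fin._≟_) (λ w → does (startsWith? j w) ∧ does (des w ℕ.≟ i)) (allWords m m) ⟩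
    sumMap (λ w → ⟦ distinct w ∧ (does (startsWith? j w) ∧ does (des w ℕ.≟ i)) ⟧) (allWords m m) ∎

  A-suc-count : ∀ m i (j : Fin (suc m)) →
    A (suc m) i j ≡ sumMap (λ w → ⟦ distinct (j ∷ w) ∧ does (desFrom j w ℕ.≟ i) ⟧) (allWords m (suc m))
  A-suc-count m i j = begin
    A (suc m) i j
      ≡⟨ A-count (suc m) i j ⟩
    sumMap F (allWords (suc m) (suc m))
      ≡⟨ sumMap-allWords-suc m (suc m) F ⟩
    sumMap (λ w → sum (λ x → F (x ∷ w))) (allWords m (suc m))
      ≡⟨ sumMap-cong (allWords m (suc m)) (λ w → sum-at j (λ x → F (x ∷ w)) (starts-elsewhere w)) ⟩
    sumMap (λ w → F (j ∷ w)) (allWords m (suc m))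
      ≡⟨ sumMap-cong (allWords m (suc m)) (λ w → cong (λ b → ⟦ distinct (j ∷ w) ∧ (b ∧ does (desFrom j w ℕ.≟ i)) ⟧)
                                                      (dec-true (j Fin.≟ j) refl)) ⟩
    sumMap (λ w → ⟦ distinct (j ∷ w) ∧ does (desFrom j w ℕ.≟ i) ⟧) (allWords m (suc m)) ∎
    where
    F = λ w → ⟦ distinct w ∧ (does (startsWith? j w) ∧ does (des w ℕ.≟ i)) ⟧
    starts-elsewhere : ∀ w k → F (punchIn j k ∷ w) ≡ 0
    starts-elsewhere w k
      rewrite dec-false (punchIn j k Fin.≟ j) (punchInᵢ≢i j k) = cong ⟦_⟧ (∧-zeroʳ (distinct (punchIn j k ∷ w)))

  sumMap-avoiding : ∀ m {n} (j : Fin (suc n)) (h : List (Fin (suc n)) → ℕ) →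
    sumMap (λ w → if avoids j w then h w else 0) (allWords m (suc n)) ≡ sumMap (h ∘ map (punchIn j)) (allWords m n)
  sumMap-avoiding zero    j h = refl
  sumMap-avoiding (suc m) {n} j h = begin
    sumMap (λ w → if avoids j w then h w else 0) (allWords (suc m) (suc n))
      ≡⟨ sumMap-allWords-suc m (suc n) _ ⟩
    sumMap (λ w → sum (λ x → if not (does (j Fin.≟ x)) ∧ avoids j w then h (x ∷ w) else 0)) (allWords m (suc n))
      ≡⟨ sumMap-cong (allWords m (suc n)) first-letter ⟩
    sumMap (λ w → if avoids j w then sum (λ k → h (punchIn j k ∷ w)) else 0) (allWords m (suc n))
      ≡⟨ sumMap-avoiding m j (λ w → sum (λ k → h (punchIn j k ∷ w))) ⟩
    sumMap (λ w → sum (λ k → h (punchIn j k ∷ map (punchIn j) w))) (allWords m n)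
      ≡⟨ sumMap-allWords-suc m n (h ∘ map (punchIn j)) ⟨
    sumMap (h ∘ map (punchIn j)) (allWords (suc m) n) ∎
    where
    first-letter : ∀ w → sum (λ x → if not (does (j Fin.≟ x)) ∧ avoids j w then h (x ∷ w) else 0)
                       ≡ (if avoids j w then sum (λ k → h (punchIn j k ∷ w)) else 0)
    first-letter w with avoids j w
    ... | true  = trans (sum-cong-≗ (λ x → cong (λ b → if b then h (x ∷ w) else 0) (∧-identityʳ (not (does (j Fin.≟ x))))))
                        (sum-except j (λ x → h (x ∷ w)))
    ... | false = sum-zero (λ x → cong (λ b → if b then h (x ∷ w) else 0) (∧-zeroʳ (not (does (j Fin.≟ x)))))

  avoids-map-punchIn : ∀ {n} (j : Fin (suc n)) (x : Fin n) (w : List (Fin n)) →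
    avoids (punchIn j x) (map (punchIn j) w) ≡ avoids x w
  avoids-map-punchIn j x []      = refl
  avoids-map-punchIn j x (y ∷ w) = cong₂ (λ a b → not a ∧ b)
    (does-⇔ (mk⇔ (punchIn-injective j x y) (cong (punchIn j))) (punchIn j x Fin.≟ punchIn j y) (x Fin.≟ y))
    (avoids-map-punchIn j x w)

  distinct-map-punchIn : ∀ {n} (j : Fin (suc n)) (w : List (Fin n)) → distinct (map (punchIn j) w) ≡ distinct w
  distinct-map-punchIn j []      = refl
  distinct-map-punchIn j (x ∷ w) = cong₂ _∧_ (avoids-map-punchIn j x w) (distinct-map-punchIn j w)

  punchIn-<ᵇ : ∀ {n} (j : Fin (suc n)) (y : Fin n) → (toℕ (punchIn j y) <ᵇ toℕ j) ≡ (toℕ y <ᵇ toℕ j)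
  punchIn-<ᵇ zero    y       = refl
  punchIn-<ᵇ (suc j) zero    = refl
  punchIn-<ᵇ (suc j) (suc y) = punchIn-<ᵇ j y

  punchIn-<ᵇ-punchIn : ∀ {n} (j : Fin (suc n)) (z y : Fin n) →
    (toℕ (punchIn j z) <ᵇ toℕ (punchIn j y)) ≡ (toℕ z <ᵇ toℕ y)
  punchIn-<ᵇ-punchIn zero    z       y       = refl
  punchIn-<ᵇ-punchIn (suc j) zero    zero    = refl
  punchIn-<ᵇ-punchIn (suc j) zero    (suc y) = refl
  punchIn-<ᵇ-punchIn (suc j) (suc z) zero    = refl
  punchIn-<ᵇ-punchIn (suc j) (suc z) (suc y) = punchIn-<ᵇ-punchIn j z y

  desFrom-∷ : ∀ {n} (x y : Fin n) (w : List (Fin n)) → desFrom x (y ∷ w) ≡ ⟦ toℕ y <ᵇ toℕ x ⟧ + desFrom y w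
  desFrom-∷ x y w = cong (λ b → ⟦ b ⟧ + desFrom y w) (isYes≗does (y <? x))

  desFrom-map-punchIn : ∀ {n} (j : Fin (suc n)) (x : Fin n) (w : List (Fin n)) →
    desFrom (punchIn j x) (map (punchIn j) w) ≡ desFrom x w
  desFrom-map-punchIn j x []      = refl
  desFrom-map-punchIn j x (y ∷ w) = begin
    desFrom (punchIn j x) (punchIn j y ∷ map (punchIn j) w)
      ≡⟨ desFrom-∷ (punchIn j x) (punchIn j y) (map (punchIn j) w) ⟩
    ⟦ toℕ (punchIn j y) <ᵇ toℕ (punchIn j x) ⟧ + desFrom (punchIn j y) (map (punchIn j) w)
      ≡⟨ cong₂ (λ b d → ⟦ b ⟧ + d) (punchIn-<ᵇ-punchIn j y x) (desFrom-map-punchIn j y w) ⟩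
    ⟦ toℕ y <ᵇ toℕ x ⟧ + desFrom y w
      ≡⟨ desFrom-∷ x y w ⟨
    desFrom x (y ∷ w) ∎

  -- the descents of j ∷ w, read off the word w over Fin m from which the value j has been removed
  desAfter : ∀ {m} → Fin (suc m) → List (Fin m) → ℕ
  desAfter j []      = 0
  desAfter j (y ∷ w) = ⟦ toℕ y <ᵇ toℕ j ⟧ + desFrom y w

  desFrom-map-punchIn-self : ∀ {m} (j : Fin (suc m)) (w : List (Fin m)) → desFrom j (map (punchIn j) w) ≡ desAfter j w
  desFrom-map-punchIn-self j []      = refl
  desFrom-map-punchIn-self j (y ∷ w) = trans (desFrom-∷ j (punchIn j y) (map (punchIn j) w))
    (cong₂ (λ b d → ⟦ b ⟧ + d) (punchIn-<ᵇ j y) (desFrom-map-punchIn j y w))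

  A-suc-standardised : ∀ m i (j : Fin (suc m)) →
    A (suc m) i j ≡ sumMap (λ w → ⟦ distinct w ∧ does (desAfter j w ℕ.≟ i) ⟧) (allWords m m)
  A-suc-standardised m i j = begin
    A (suc m) i j
      ≡⟨ A-suc-count m i j ⟩
    sumMap (λ w → ⟦ (avoids j w ∧ distinct w) ∧ does (desFrom j w ℕ.≟ i) ⟧) (allWords m (suc m))
      ≡⟨ sumMap-cong (allWords m (suc m)) (λ w → guard (avoids j w) (distinct w) (does (desFrom j w ℕ.≟ i))) ⟩
    sumMap (λ w → if avoids j w then ⟦ distinct w ∧ does (desFrom j w ℕ.≟ i) ⟧ else 0) (allWords m (suc m))
      ≡⟨ sumMap-avoiding m j (λ w → ⟦ distinct w ∧ does (desFrom j w ℕ.≟ i) ⟧) ⟩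
    sumMap (λ w → ⟦ distinct (map (punchIn j) w) ∧ does (desFrom j (map (punchIn j) w) ℕ.≟ i) ⟧) (allWords m m)
      ≡⟨ sumMap-cong (allWords m m) (λ w → cong₂ (λ u d → ⟦ u ∧ does (d ℕ.≟ i) ⟧)
                                                (distinct-map-punchIn j w) (desFrom-map-punchIn-self j w)) ⟩
    sumMap (λ w → ⟦ distinct w ∧ does (desAfter j w ℕ.≟ i) ⟧) (allWords m m) ∎
    where
    guard : ∀ a b c → ⟦ (a ∧ b) ∧ c ⟧ ≡ (if a then ⟦ b ∧ c ⟧ else 0)
    guard true  b c = refl
    guard false b c = refl

  -- Delete the first letter j and standardise: what remains starts with some k, and the first
  -- position of the original permutation was a descent exactly when k < j.
  A-recurrence : ∀ m i (j : Fin (suc (suc m))) →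
    A (suc (suc m)) i j ≡
    sum (λ k → if toℕ k <ᵇ toℕ j then shift (λ i′ → A (suc m) i′ k) i else A (suc m) i k)
  A-recurrence m i j = begin
    A (suc (suc m)) i j
      ≡⟨ A-suc-standardised (suc m) i j ⟩
    sumMap (λ w → ⟦ distinct w ∧ does (desAfter j w ℕ.≟ i) ⟧) (allWords (suc m) (suc m))
      ≡⟨ sumMap-allWords-suc m (suc m) _ ⟩
    sumMap (λ w → sum (λ y → ⟦ distinct (y ∷ w) ∧ does (desAfter j (y ∷ w) ℕ.≟ i) ⟧)) (allWords m (suc m))
      ≡⟨ sumMap-cong (allWords m (suc m)) (λ w → sum-cong-≗ (λ y → first-step y w i)) ⟩
    sumMap (λ w → sum (λ y → if toℕ y <ᵇ toℕ j then shift (count y w) i else count y w i)) (allWords m (suc m))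
      ≡⟨ sumMap-sum (λ w y → if toℕ y <ᵇ toℕ j then shift (count y w) i else count y w i) (allWords m (suc m)) ⟩
    sum (λ y → sumMap (λ w → if toℕ y <ᵇ toℕ j then shift (count y w) i else count y w i) (allWords m (suc m)))
      ≡⟨ sum-cong-≗ per-letter ⟩
    sum (λ k → if toℕ k <ᵇ toℕ j then shift (λ i′ → A (suc m) i′ k) i else A (suc m) i k) ∎
    where
    count : Fin (suc m) → List (Fin (suc m)) → ℕ → ℕ
    count y w i′ = ⟦ distinct (y ∷ w) ∧ does (desFrom y w ℕ.≟ i′) ⟧
    first-step : ∀ y w i → ⟦ distinct (y ∷ w) ∧ does (desAfter j (y ∷ w) ℕ.≟ i) ⟧ ≡
                           (if toℕ y <ᵇ toℕ j then shift (count y w) i else count y w i)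
    first-step y w i with toℕ y <ᵇ toℕ j
    first-step y w zero    | true  = cong ⟦_⟧ (∧-zeroʳ (distinct (y ∷ w)))
    first-step y w (suc i) | true  = refl
    ... | false = refl
    per-letter : ∀ y →
      sumMap (λ w → if toℕ y <ᵇ toℕ j then shift (count y w) i else count y w i) (allWords m (suc m)) ≡
      (if toℕ y <ᵇ toℕ j then shift (λ i′ → A (suc m) i′ y) i else A (suc m) i y)
    per-letter y = trans
      (sumMap-if (toℕ y <ᵇ toℕ j) (λ w → shift (count y w) i) (λ w → count y w i) (allWords m (suc m)))
      (cong₂ (if toℕ y <ᵇ toℕ j then_else_)
             (trans (sumMap-shift (count y) (allWords m (suc m)) i) (shift-cong (λ i′ → sym (A-suc-count m i′ y)) i))
             (sym (A-suc-count m i y)))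

  A-vanishes : ∀ d i (j : Fin (suc d)) → d < i → A (suc d) i j ≡ 0
  A-vanishes zero    (suc i) zero _           = refl
  A-vanishes (suc d) (suc i) j    (s≤s d<i) = trans (A-recurrence d (suc i) j) (sum-zero vanishes)
    where
    vanishes : ∀ k → (if toℕ k <ᵇ toℕ j then A (suc d) i k else A (suc d) (suc i) k) ≡ 0
    vanishes k with toℕ k <ᵇ toℕ j
    ... | true  = A-vanishes d i k d<i
    ... | false = A-vanishes d (suc i) k (ℕ.m<n⇒m<1+n d<i)

module Binomial where

  open NatSums

  open import Data.Nat as ℕ using (ℕ; zero; suc; _+_; _*_; _≤_; _<_; z≤n; s≤s)
  import Data.Nat.Properties as ℕ
  open import Data.Nat.Combinatorics using (_C_; nCn≡1; k>n⇒nCk≡0; nCk≡nC[n∸k]; nCk+nC[k+1]≡[n+1]C[k+1])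
  open import Data.Nat.Tactic.RingSolver using (solve-∀)
  open import Algebra.Properties.Semiring.Sum ℕ.+-*-semiring
    using (sum-syntax; sum-cong-≗; ∑-distrib-+; *-distribˡ-sum)
  open import Data.Fin using (zero; suc; toℕ)
  open import Relation.Binary.PropositionalEquality
  open ≡-Reasoning

  nC0≡1 : ∀ n → n C 0 ≡ 1
  nC0≡1 n = trans (nCk≡nC[n∸k] {k = 0} {n = n} z≤n) (nCn≡1 n)

  pascal : ∀ n k → suc n C suc k ≡ n C k + n C suc k
  pascal n k = sym (nCk+nC[k+1]≡[n+1]C[k+1] n k)

  S-vanishes : ∀ n k → n < k → S n k ≡ 0
  S-vanishes zero    (suc k) _         = refl
  S-vanishes (suc n) (suc k) (s≤s n<k) = trans
    (cong₂ (λ a b → suc k * a + b) (S-vanishes n (suc k) (ℕ.m<n⇒m<1+n n<k)) (S-vanishes n k n<k))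
    (cong (_+ 0) (ℕ.*-zeroʳ (suc k)))

  S-diag : ∀ n → S n n ≡ 1
  S-diag zero    = refl
  S-diag (suc n) = trans (cong₂ (λ a b → suc n * a + b) (S-vanishes n (suc n) (ℕ.n<1+n n)) (S-diag n))
    (cong (_+ 1) (ℕ.*-zeroʳ (suc n)))

  S-binomial : ∀ n k → ∑[ i < suc n ] ((n C toℕ i) * S (toℕ i) k) ≡ S (suc n) (suc k)
  S-binomial-shifted : ∀ n k →
    ∑[ i < suc n ] ((n C toℕ i) * S (suc (toℕ i)) k) ≡ k * S (suc n) (suc k) + S (suc n) k

  S-binomial zero k = trans (ℕ.+-identityʳ _) (trans (ℕ.*-identityˡ (S 0 k)) (sym (cong (_+ S 0 k) (ℕ.*-zeroʳ (suc k)))))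
  S-binomial (suc n) k = begin
    (suc n C 0) * S 0 k + ∑[ i < suc n ] ((suc n C suc (toℕ i)) * S (suc (toℕ i)) k)
      ≡⟨ cong₂ (λ c s → c * S 0 k + s) (nC0≡1 (suc n))
               (trans (sum-cong-≗ {suc n} (λ i → trans (cong (_* S (suc (toℕ i)) k) (pascal n (toℕ i)))
                                             (ℕ.*-distribʳ-+ (S (suc (toℕ i)) k) (n C toℕ i) (n C suc (toℕ i)))))
                      (∑-distrib-+ {suc n} (λ i → (n C toℕ i) * S (suc (toℕ i)) k)
                                           (λ i → (n C suc (toℕ i)) * S (suc (toℕ i)) k))) ⟩
    1 * S 0 k + (X + Y)
      ≡⟨ rearrange (S 0 k) X Y ⟩
    X + (1 * S 0 k + Y)
      ≡⟨ cong₂ (λ x c → x + (c * S 0 k + Y)) (S-binomial-shifted n k) (sym (nC0≡1 n)) ⟩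
    (k * S (suc n) (suc k) + S (suc n) k) + ((n C 0) * S 0 k + Y)
      ≡⟨ cong ((k * S (suc n) (suc k) + S (suc n) k) +_) (trans drop-top-term (S-binomial n k)) ⟩
    (k * S (suc n) (suc k) + S (suc n) k) + S (suc n) (suc k)
      ≡⟨ collect k (S (suc n) (suc k)) (S (suc n) k) ⟩
    suc k * S (suc n) (suc k) + S (suc n) k ∎
    where
    X = ∑[ i < suc n ] ((n C toℕ i) * S (suc (toℕ i)) k)
    Y = ∑[ i < suc n ] ((n C suc (toℕ i)) * S (suc (toℕ i)) k)
    rearrange : ∀ s x y → 1 * s + (x + y) ≡ x + (1 * s + y)
    rearrange = solve-∀
    collect : ∀ k x y → (k * x + y) + x ≡ suc k * x + y
    collect = solve-∀
    drop-top-term : ∑[ i < suc (suc n) ] ((n C toℕ i) * S (toℕ i) k) ≡ ∑[ i < suc n ] ((n C toℕ i) * S (toℕ i) k)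
    drop-top-term = begin
      ∑[ i < suc (suc n) ] ((n C toℕ i) * S (toℕ i) k)
        ≡⟨ sum-last (suc n) (λ i → (n C i) * S i k) ⟩
      ∑[ i < suc n ] ((n C toℕ i) * S (toℕ i) k) + (n C suc n) * S (suc n) k
        ≡⟨ cong (λ c → ∑[ i < suc n ] ((n C toℕ i) * S (toℕ i) k) + c * S (suc n) k) (k>n⇒nCk≡0 (ℕ.n<1+n n)) ⟩
      ∑[ i < suc n ] ((n C toℕ i) * S (toℕ i) k) + 0
        ≡⟨ ℕ.+-identityʳ _ ⟩
      ∑[ i < suc n ] ((n C toℕ i) * S (toℕ i) k) ∎

  S-binomial-shifted n zero     = sum-zero {suc n} (λ i → ℕ.*-zeroʳ (n C toℕ i))
  S-binomial-shifted n (suc k) = begin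
    ∑[ i < suc n ] ((n C toℕ i) * (suc k * S (toℕ i) (suc k) + S (toℕ i) k))
      ≡⟨ sum-cong-≗ {suc n} (λ i → distribute (n C toℕ i) (suc k) (S (toℕ i) (suc k)) (S (toℕ i) k)) ⟩
    ∑[ i < suc n ] (suc k * ((n C toℕ i) * S (toℕ i) (suc k)) + (n C toℕ i) * S (toℕ i) k)
      ≡⟨ ∑-distrib-+ {suc n} (λ i → suc k * ((n C toℕ i) * S (toℕ i) (suc k))) (λ i → (n C toℕ i) * S (toℕ i) k) ⟩
    ∑[ i < suc n ] (suc k * ((n C toℕ i) * S (toℕ i) (suc k))) + ∑[ i < suc n ] ((n C toℕ i) * S (toℕ i) k)
      ≡⟨ cong₂ _+_ (trans (sym (*-distribˡ-sum {suc n} (suc k) (λ i → (n C toℕ i) * S (toℕ i) (suc k))))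
                          (cong (suc k *_) (S-binomial n (suc k))))
                   (S-binomial n k) ⟩
    suc k * S (suc n) (suc (suc k)) + S (suc n) (suc k) ∎
    where
    distribute : ∀ c a x y → c * (a * x + y) ≡ a * (c * x) + c * y
    distribute = solve-∀

  S-binomial-init : ∀ n k → ∑[ i < suc n ] ((suc n C toℕ i) * S (toℕ i) k) ≡ suc k * S (suc n) (suc k)
  S-binomial-init n k = ℕ.+-cancelʳ-≡ (S (suc n) k) _ _ (begin
    ∑[ i < suc n ] ((suc n C toℕ i) * S (toℕ i) k) + S (suc n) k
      ≡⟨ cong (∑[ i < suc n ] ((suc n C toℕ i) * S (toℕ i) k) +_)
              (sym (trans (cong (_* S (suc n) k) (nCn≡1 (suc n))) (ℕ.*-identityˡ _))) ⟩
    ∑[ i < suc n ] ((suc n C toℕ i) * S (toℕ i) k) + (suc n C suc n) * S (suc n) k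
      ≡⟨ sum-last (suc n) (λ i → (suc n C i) * S i k) ⟨
    ∑[ i < suc (suc n) ] ((suc n C toℕ i) * S (toℕ i) k)
      ≡⟨ S-binomial (suc n) k ⟩
    suc k * S (suc n) (suc k) + S (suc n) k ∎)

  -- 𝔗 d k i = C(d − i, k − i) when i ≤ k, and 0 otherwise
  𝔗 : ℕ → ℕ → ℕ → ℕ
  𝔗 d       k       zero    = d C k
  𝔗 d       zero    (suc i) = 0
  𝔗 zero    (suc k) (suc i) = 0
  𝔗 (suc d) (suc k) (suc i) = 𝔗 d k i

  𝔗-suc-col : ∀ d k i → 𝔗 (suc d) k (suc i) ≡ shift (λ k′ → 𝔗 d k′ i) k
  𝔗-suc-col d zero    i = refl
  𝔗-suc-col d (suc k) i = refl

  𝔗-above : ∀ d k i → k < i → 𝔗 d k i ≡ 0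
  𝔗-above d       zero    (suc i) _         = refl
  𝔗-above zero    (suc k) (suc i) _         = refl
  𝔗-above (suc d) (suc k) (suc i) (s≤s k<i) = 𝔗-above d k i k<i

  𝔗-below : ∀ d k i → d < k → 𝔗 d k i ≡ 0
  𝔗-below d       k       zero    d<k       = k>n⇒nCk≡0 d<k
  𝔗-below zero    (suc k) (suc i) _         = refl
  𝔗-below (suc d) (suc k) (suc i) (s≤s d<k) = 𝔗-below d k i d<k

  𝔗-diag : ∀ d k → k ≤ d → 𝔗 d k k ≡ 1
  𝔗-diag d       zero    _         = nC0≡1 d
  𝔗-diag (suc d) (suc k) (s≤s k≤d) = 𝔗-diag d k k≤d

  𝔗-pascal-row : ∀ d k i → i ≤ d → 𝔗 (suc d) k i ≡ 𝔗 d k i + shift (λ k′ → 𝔗 d k′ i) k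
  𝔗-pascal-row d       zero    zero    _         = trans (nC0≡1 (suc d)) (sym (trans (ℕ.+-identityʳ (d C 0)) (nC0≡1 d)))
  𝔗-pascal-row d       (suc k) zero    _         = trans (pascal d k) (ℕ.+-comm (d C k) (d C suc k))
  𝔗-pascal-row (suc d) zero    (suc i) _         = refl
  𝔗-pascal-row (suc d) (suc k) (suc i) (s≤s i≤d) =
    trans (𝔗-pascal-row d k i i≤d) (cong (𝔗 d k i +_) (sym (𝔗-suc-col d k i)))

  𝔗-pascal-col : ∀ d i j → j ≤ d → 𝔗 (suc d) i j ≡ 𝔗 d i j + 𝔗 (suc d) i (suc j)
  𝔗-pascal-col d       zero    zero    _         = trans (nC0≡1 (suc d)) (sym (trans (ℕ.+-identityʳ (d C 0)) (nC0≡1 d)))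
  𝔗-pascal-col d       (suc i) zero    _         = trans (pascal d i) (ℕ.+-comm (d C i) (d C suc i))
  𝔗-pascal-col (suc d) zero    (suc j) _         = refl
  𝔗-pascal-col (suc d) (suc i) (suc j) (s≤s j≤d) = 𝔗-pascal-col d i j j≤d

  𝔗-hockey-stick : ∀ d i → i ≤ d → ∑[ k < suc d ] 𝔗 d i (toℕ k) ≡ suc d C i
  𝔗-hockey-stick d       zero    _         =
    trans (cong₂ _+_ (nC0≡1 d) (sum-zero {d} (λ _ → refl))) (sym (nC0≡1 (suc d)))
  𝔗-hockey-stick (suc d) (suc i) (s≤s i≤d) =
    trans (cong (suc d C suc i +_) (𝔗-hockey-stick d i i≤d))
          (trans (ℕ.+-comm (suc d C suc i) (suc d C i)) (sym (pascal (suc d) i)))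

module Intertwiner where

  open NatSums
  open Binomial
  open Descents using (A-recurrence; A-vanishes)

  open import Data.Nat as ℕ using (ℕ; zero; suc; _+_; _*_; _!; _<ᵇ_)
  import Data.Nat.Properties as ℕ
  open import Data.Nat.Combinatorics using (_C_)
  open import Data.Nat.Tactic.RingSolver using (solve-∀)
  open import Algebra.Properties.Semiring.Sum ℕ.+-*-semiring
    using (sum-syntax; sum-cong-≗; ∑-distrib-+; ∑-comm; *-distribˡ-sum)
  open import Data.Fin using (Fin; zero; suc; toℕ)
  open import Data.Fin.Properties using (toℕ<n)
  open import Data.Bool using (true; false; if_then_else_)
  open import Relation.Binary.PropositionalEquality
  open ≡-Reasoning

  -- one step d ↦ d + 1 of the recurrence shared by 𝔗 ℌ and 𝔉 𝔗 (row k, column j)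
  step : ∀ d → (ℕ → Fin (suc d) → ℕ) → ℕ → Fin (suc (suc d)) → ℕ
  step d X k j = ∑[ k′ < suc d ] (shift (λ k″ → X k″ k′) k + (if toℕ k′ <ᵇ toℕ j then 0 else X k k′))

  step-cong : ∀ d {X Y : ℕ → Fin (suc d) → ℕ} → (∀ k j → X k j ≡ Y k j) → ∀ k j → step d X k j ≡ step d Y k j
  step-cong d X≗Y k j = sum-cong-≗ {suc d} (λ k′ → cong₂ _+_ (shift-cong (λ k″ → X≗Y k″ k′) k)
                                                            (cong (if toℕ k′ <ᵇ toℕ j then 0 else_) (X≗Y k k′)))

  -- the column of 𝔉𝔗 is a natural number rather than an element of Fin (suc d)
  -- so that the telescoping in 𝔉𝔗-step can run over it
  𝔗ℌ : ∀ d → ℕ → Fin (suc d) → ℕ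
  𝔗ℌ d k j = ∑[ i < suc d ] (𝔗 d k (toℕ i) * A (suc d) (toℕ i) j)

  𝔉𝔗 : ∀ d → ℕ → ℕ → ℕ
  𝔉𝔗 d k j = ∑[ i < suc d ] (k ! * S (toℕ i) k * 𝔗 d (toℕ i) j)

  𝔗-shift-sum : ∀ d k (g : ℕ → ℕ) →
    ∑[ i < suc (suc d) ] (𝔗 (suc d) k (toℕ i) * shift g (toℕ i)) ≡
    shift (λ k′ → ∑[ i < suc d ] (𝔗 d k′ (toℕ i) * g (toℕ i))) k
  𝔗-shift-sum d k g = begin
    𝔗 (suc d) k 0 * 0 + ∑[ i < suc d ] (𝔗 (suc d) k (suc (toℕ i)) * g (toℕ i))
      ≡⟨ cong₂ _+_ (ℕ.*-zeroʳ (𝔗 (suc d) k 0))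
               (sum-cong-≗ {suc d} (λ i → trans (cong (_* g (toℕ i)) (𝔗-suc-col d k (toℕ i)))
                                                (shift-* (λ k′ → 𝔗 d k′ (toℕ i)) (g (toℕ i)) k))) ⟩
    ∑[ i < suc d ] shift (λ k′ → 𝔗 d k′ (toℕ i) * g (toℕ i)) k
      ≡⟨ sum-shift {suc d} (λ k′ i → 𝔗 d k′ (toℕ i) * g (toℕ i)) k ⟩
    shift (λ k′ → ∑[ i < suc d ] (𝔗 d k′ (toℕ i) * g (toℕ i))) k ∎

  𝔗-A-pascal : ∀ d k (j : Fin (suc d)) →
    ∑[ i < suc (suc d) ] (𝔗 (suc d) k (toℕ i) * A (suc d) (toℕ i) j) ≡ 𝔗ℌ d k j + shift (λ k′ → 𝔗ℌ d k′ j) k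
  𝔗-A-pascal d k j = begin
    ∑[ i < suc (suc d) ] (𝔗 (suc d) k (toℕ i) * A (suc d) (toℕ i) j)
      ≡⟨ sum-last (suc d) (λ i → 𝔗 (suc d) k i * A (suc d) i j) ⟩
    ∑[ i < suc d ] (𝔗 (suc d) k (toℕ i) * A (suc d) (toℕ i) j) + 𝔗 (suc d) k (suc d) * A (suc d) (suc d) j
      ≡⟨ cong (∑[ i < suc d ] (𝔗 (suc d) k (toℕ i) * A (suc d) (toℕ i) j) +_)
              (trans (cong (𝔗 (suc d) k (suc d) *_) (A-vanishes d (suc d) j (ℕ.n<1+n d)))
                     (ℕ.*-zeroʳ (𝔗 (suc d) k (suc d)))) ⟩
    ∑[ i < suc d ] (𝔗 (suc d) k (toℕ i) * A (suc d) (toℕ i) j) + 0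
      ≡⟨ ℕ.+-identityʳ _ ⟩
    ∑[ i < suc d ] (𝔗 (suc d) k (toℕ i) * A (suc d) (toℕ i) j)
      ≡⟨ sum-cong-≗ {suc d} (λ i → trans (cong (_* A (suc d) (toℕ i) j) (𝔗-pascal-row d k (toℕ i) (ℕ.s≤s⁻¹ (toℕ<n i))))
                                         (ℕ.*-distribʳ-+ (A (suc d) (toℕ i) j) (𝔗 d k (toℕ i)) _)) ⟩
    ∑[ i < suc d ] (𝔗 d k (toℕ i) * A (suc d) (toℕ i) j + shift (λ k′ → 𝔗 d k′ (toℕ i)) k * A (suc d) (toℕ i) j)
      ≡⟨ ∑-distrib-+ {suc d} (λ i → 𝔗 d k (toℕ i) * A (suc d) (toℕ i) j)
                             (λ i → shift (λ k′ → 𝔗 d k′ (toℕ i)) k * A (suc d) (toℕ i) j) ⟩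
    𝔗ℌ d k j + ∑[ i < suc d ] (shift (λ k′ → 𝔗 d k′ (toℕ i)) k * A (suc d) (toℕ i) j)
      ≡⟨ cong (𝔗ℌ d k j +_) (trans (sum-cong-≗ {suc d} (λ i → shift-* (λ k′ → 𝔗 d k′ (toℕ i)) (A (suc d) (toℕ i) j) k))
                                   (sum-shift {suc d} (λ k′ i → 𝔗 d k′ (toℕ i) * A (suc d) (toℕ i) j) k)) ⟩
    𝔗ℌ d k j + shift (λ k′ → 𝔗ℌ d k′ j) k ∎

  𝔗ℌ-step : ∀ d k j → 𝔗ℌ (suc d) k j ≡ step d (𝔗ℌ d) k j
  𝔗ℌ-step d k j = begin
    ∑[ i < suc (suc d) ] (𝔗 (suc d) k (toℕ i) * A (suc (suc d)) (toℕ i) j)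
      ≡⟨ sum-cong-≗ {suc (suc d)} (λ i → trans (cong (𝔗 (suc d) k (toℕ i) *_) (A-recurrence d (toℕ i) j))
                                              (*-distribˡ-sum {suc d} (𝔗 (suc d) k (toℕ i)) (R (toℕ i)))) ⟩
    ∑[ i < suc (suc d) ] ∑[ k′ < suc d ] (𝔗 (suc d) k (toℕ i) * R (toℕ i) k′)
      ≡⟨ ∑-comm {suc (suc d)} {suc d} (λ i k′ → 𝔗 (suc d) k (toℕ i) * R (toℕ i) k′) ⟩
    ∑[ k′ < suc d ] ∑[ i < suc (suc d) ] (𝔗 (suc d) k (toℕ i) * R (toℕ i) k′)
      ≡⟨ sum-cong-≗ {suc d} column ⟩
    step d (𝔗ℌ d) k j ∎
    where
    R : ℕ → Fin (suc d) → ℕ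
    R i k′ = if toℕ k′ <ᵇ toℕ j then shift (λ i′ → A (suc d) i′ k′) i else A (suc d) i k′
    column : ∀ k′ → ∑[ i < suc (suc d) ] (𝔗 (suc d) k (toℕ i) * R (toℕ i) k′) ≡
                    shift (λ k″ → 𝔗ℌ d k″ k′) k + (if toℕ k′ <ᵇ toℕ j then 0 else 𝔗ℌ d k k′)
    column k′ with toℕ k′ <ᵇ toℕ j
    ... | true  = trans (𝔗-shift-sum d k (λ i′ → A (suc d) i′ k′)) (sym (ℕ.+-identityʳ _))
    ... | false = trans (𝔗-A-pascal d k k′) (ℕ.+-comm (𝔗ℌ d k k′) _)

  𝔉𝔗-pascal : ∀ d k j → j ≤ d → 𝔉𝔗 (suc d) k j ≡ 𝔉𝔗 d k j + 𝔉𝔗 (suc d) k (suc j)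
  𝔉𝔗-pascal d k j j≤d = begin
    ∑[ i < suc (suc d) ] (s (toℕ i) * 𝔗 (suc d) (toℕ i) j)
      ≡⟨ sum-cong-≗ {suc (suc d)} (λ i → trans (cong (s (toℕ i) *_) (𝔗-pascal-col d (toℕ i) j j≤d))
                                              (ℕ.*-distribˡ-+ (s (toℕ i)) (𝔗 d (toℕ i) j) _)) ⟩
    ∑[ i < suc (suc d) ] (s (toℕ i) * 𝔗 d (toℕ i) j + s (toℕ i) * 𝔗 (suc d) (toℕ i) (suc j))
      ≡⟨ ∑-distrib-+ {suc (suc d)} (λ i → s (toℕ i) * 𝔗 d (toℕ i) j)
                                   (λ i → s (toℕ i) * 𝔗 (suc d) (toℕ i) (suc j)) ⟩
    ∑[ i < suc (suc d) ] (s (toℕ i) * 𝔗 d (toℕ i) j) + 𝔉𝔗 (suc d) k (suc j)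
      ≡⟨ cong (_+ 𝔉𝔗 (suc d) k (suc j)) (trans (sum-last (suc d) (λ i → s i * 𝔗 d i j))
           (trans (cong (𝔉𝔗 d k j +_) (trans (cong (s (suc d) *_) (𝔗-below d (suc d) j (ℕ.n<1+n d))) (ℕ.*-zeroʳ (s (suc d)))))
                  (ℕ.+-identityʳ (𝔉𝔗 d k j)))) ⟩
    𝔉𝔗 d k j + 𝔉𝔗 (suc d) k (suc j) ∎
    where
    s : ℕ → ℕ
    s i = k ! * S i k

  𝔉𝔗-top : ∀ d k → 𝔉𝔗 (suc d) k (suc d) ≡ ∑[ k′ < suc d ] shift (λ k″ → 𝔉𝔗 d k″ (toℕ k′)) k
  𝔉𝔗-top d k = trans corner (row k)
    where
    s : ℕ → ℕ → ℕ
    s k i = k ! * S i k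
    corner : 𝔉𝔗 (suc d) k (suc d) ≡ s k (suc d)
    corner = begin
      ∑[ i < suc (suc d) ] (s k (toℕ i) * 𝔗 (suc d) (toℕ i) (suc d))
        ≡⟨ sum-last (suc d) (λ i → s k i * 𝔗 (suc d) i (suc d)) ⟩
      ∑[ i < suc d ] (s k (toℕ i) * 𝔗 (suc d) (toℕ i) (suc d)) + s k (suc d) * 𝔗 (suc d) (suc d) (suc d)
        ≡⟨ cong₂ _+_ (sum-zero {suc d} (λ i → trans (cong (s k (toℕ i) *_) (𝔗-above (suc d) (toℕ i) (suc d) (toℕ<n i)))
                                                    (ℕ.*-zeroʳ (s k (toℕ i)))))
                     (trans (cong (s k (suc d) *_) (𝔗-diag (suc d) (suc d) ℕ.≤-refl)) (ℕ.*-identityʳ (s k (suc d)))) ⟩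
      s k (suc d) ∎
    row : ∀ k → s k (suc d) ≡ ∑[ k′ < suc d ] shift (λ k″ → 𝔉𝔗 d k″ (toℕ k′)) k
    row zero     = sym (sum-zero {suc d} (λ _ → refl))
    row (suc k) = sym (begin
      ∑[ k′ < suc d ] ∑[ i < suc d ] (s k (toℕ i) * 𝔗 d (toℕ i) (toℕ k′))
        ≡⟨ ∑-comm {suc d} {suc d} (λ k′ i → s k (toℕ i) * 𝔗 d (toℕ i) (toℕ k′)) ⟩
      ∑[ i < suc d ] ∑[ k′ < suc d ] (s k (toℕ i) * 𝔗 d (toℕ i) (toℕ k′))
        ≡⟨ sum-cong-≗ {suc d} (λ i → trans (sym (*-distribˡ-sum {suc d} (s k (toℕ i)) (λ k′ → 𝔗 d (toℕ i) (toℕ k′))))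
                                          (cong (s k (toℕ i) *_) (𝔗-hockey-stick d (toℕ i) (ℕ.s≤s⁻¹ (toℕ<n i))))) ⟩
      ∑[ i < suc d ] (k ! * S (toℕ i) k * (suc d C toℕ i))
        ≡⟨ sum-cong-≗ {suc d} (λ i → reassociate (k !) (S (toℕ i) k) (suc d C toℕ i)) ⟩
      ∑[ i < suc d ] (k ! * ((suc d C toℕ i) * S (toℕ i) k))
        ≡⟨ *-distribˡ-sum {suc d} (k !) (λ i → (suc d C toℕ i) * S (toℕ i) k) ⟨
      k ! * ∑[ i < suc d ] ((suc d C toℕ i) * S (toℕ i) k)
        ≡⟨ cong (k ! *_) (S-binomial-init d k) ⟩
      k ! * (suc k * S (suc d) (suc k))
        ≡⟨ factorial-step (k !) (suc k) (S (suc d) (suc k)) ⟩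
      suc k ! * S (suc d) (suc k) ∎)
      where
      reassociate : ∀ a b c → a * b * c ≡ a * (c * b)
      reassociate = solve-∀
      factorial-step : ∀ a b c → a * (b * c) ≡ b * a * c
      factorial-step = solve-∀

  𝔉𝔗-step : ∀ d k (j : Fin (suc (suc d))) →
    𝔉𝔗 (suc d) k (toℕ j) ≡ step d (λ k′ j′ → 𝔉𝔗 d k′ (toℕ j′)) k j
  𝔉𝔗-step d k j = begin
    𝔉𝔗 (suc d) k (toℕ j)
      ≡⟨ telescope (suc d) (𝔉𝔗 (suc d) k) (𝔉𝔗 d k) (λ j′ j′<d → 𝔉𝔗-pascal d k j′ (ℕ.s≤s⁻¹ j′<d)) j ⟩
    ∑[ k′ < suc d ] (if toℕ k′ <ᵇ toℕ j then 0 else 𝔉𝔗 d k (toℕ k′)) + 𝔉𝔗 (suc d) k (suc d)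
      ≡⟨ ℕ.+-comm _ (𝔉𝔗 (suc d) k (suc d)) ⟩
    𝔉𝔗 (suc d) k (suc d) + ∑[ k′ < suc d ] (if toℕ k′ <ᵇ toℕ j then 0 else 𝔉𝔗 d k (toℕ k′))
      ≡⟨ cong (_+ ∑[ k′ < suc d ] (if toℕ k′ <ᵇ toℕ j then 0 else 𝔉𝔗 d k (toℕ k′))) (𝔉𝔗-top d k) ⟩
    ∑[ k′ < suc d ] shift (λ k″ → 𝔉𝔗 d k″ (toℕ k′)) k +
    ∑[ k′ < suc d ] (if toℕ k′ <ᵇ toℕ j then 0 else 𝔉𝔗 d k (toℕ k′))
      ≡⟨ ∑-distrib-+ {suc d} (λ k′ → shift (λ k″ → 𝔉𝔗 d k″ (toℕ k′)) k)
                              (λ k′ → if toℕ k′ <ᵇ toℕ j then 0 else 𝔉𝔗 d k (toℕ k′)) ⟨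
    step d (λ k′ j′ → 𝔉𝔗 d k′ (toℕ j′)) k j ∎

  𝔗ℌ≡𝔉𝔗 : ∀ d k (j : Fin (suc d)) → 𝔗ℌ d k j ≡ 𝔉𝔗 d k (toℕ j)
  𝔗ℌ≡𝔉𝔗 zero    zero    zero = refl
  𝔗ℌ≡𝔉𝔗 zero    (suc k) zero = sym (cong (λ x → x * 1 + 0) (ℕ.*-zeroʳ (suc k !)))
  𝔗ℌ≡𝔉𝔗 (suc d) k       j    = begin
    𝔗ℌ (suc d) k j                               ≡⟨ 𝔗ℌ-step d k j ⟩
    step d (𝔗ℌ d) k j                            ≡⟨ step-cong d (𝔗ℌ≡𝔉𝔗 d) k j ⟩
    step d (λ k′ j′ → 𝔉𝔗 d k′ (toℕ j′)) k j    ≡⟨ 𝔉𝔗-step d k j ⟨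
    𝔉𝔗 (suc d) k (toℕ j)                        ∎

module Similarity where

  open import Data.Nat as ℕ using (ℕ; zero; suc; _!; _<_; z≤n; s≤s)
  import Data.Nat.Properties as ℕ
  open import Algebra.Properties.Semiring.Sum ℕ.+-*-semiring using (sum)
  open import Data.Fin using (Fin; zero; suc; toℕ)
  open import Data.Fin.Properties using (toℕ<n)
  open import Data.Rational using (0ℚ; _+_; _*_)
  open import Data.Product using (_,_; proj₁; proj₂)
  open import Data.Sum using (inj₁; inj₂)
  open import Relation.Binary.PropositionalEquality
  open ≡-Reasoning
  open Embedding
  open Matrices
  open Triangular
  open Binomial using (S-vanishes; S-diag; 𝔗; 𝔗-above; 𝔗-diag)
  open Intertwiner

  Σ[<]-ℕ→ℚ : ∀ {n} (f : Fin n → ℕ) → Σ[<] (λ i → ℕ→ℚ (f i)) ≡ ℕ→ℚ (sum f)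
  Σ[<]-ℕ→ℚ {zero}  f = refl
  Σ[<]-ℕ→ℚ {suc n} f = trans (cong (ℕ→ℚ (f zero) +_) (Σ[<]-ℕ→ℚ (λ i → f (suc i)))) (sym (ℕ→ℚ-+ (f zero) _))

  Σ[<]-ℕ→ℚ-* : ∀ {n} (f g : Fin n → ℕ) →
    Σ[<] (λ i → ℕ→ℚ (f i) * ℕ→ℚ (g i)) ≡ ℕ→ℚ (sum (λ i → f i ℕ.* g i))
  Σ[<]-ℕ→ℚ-* f g = trans (Σ[<]-cong (λ i → sym (ℕ→ℚ-* (f i) (g i)))) (Σ[<]-ℕ→ℚ (λ i → f i ℕ.* g i))

  𝕋 : ∀ d → Mat (suc d)
  𝕋 d k i = ℕ→ℚ (𝔗 d (toℕ k) (toℕ i))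

  𝕋-lowerUnitriangular : ∀ d → LowerUnitriangular (𝕋 d)
  𝕋-lowerUnitriangular d =
    (λ k i k<i → cong ℕ→ℚ (𝔗-above d (toℕ k) (toℕ i) k<i)) ,
    (λ k → cong ℕ→ℚ (𝔗-diag d (toℕ k) (ℕ.s≤s⁻¹ (toℕ<n k))))

  𝔉𝕋≋𝕋ℌ : ∀ d → (𝔉 d ⊗ 𝕋 d) ≋ (𝕋 d ⊗ ℌ d)
  𝔉𝕋≋𝕋ℌ d k j = begin
    (𝔉 d ⊗ 𝕋 d) k j
      ≡⟨ Σ[<]-ℕ→ℚ-* {suc d} (λ i → toℕ k ! ℕ.* S (toℕ i) (toℕ k)) (λ i → 𝔗 d (toℕ i) (toℕ j)) ⟩
    ℕ→ℚ (𝔉𝔗 d (toℕ k) (toℕ j))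
      ≡⟨ cong ℕ→ℚ (𝔗ℌ≡𝔉𝔗 d (toℕ k) j) ⟨
    ℕ→ℚ (𝔗ℌ d (toℕ k) j)
      ≡⟨ Σ[<]-ℕ→ℚ-* {suc d} (λ i → 𝔗 d (toℕ k) (toℕ i)) (λ i → A (suc d) (toℕ i) j) ⟨
    (𝕋 d ⊗ ℌ d) k j ∎

  𝔉∼ℌ : ∀ d → Similar (𝔉 d) (ℌ d)
  𝔉∼ℌ d = intertwining⇒Similar {M = 𝔉 d} {ℌ d} {𝕋 d} {proj₁ 𝕋⁻¹} (proj₂ 𝕋⁻¹) (𝔉𝕋≋𝕋ℌ d)
    where
    𝕋⁻¹ = lowerUnitriangular-invertible (𝕋 d) (𝕋-lowerUnitriangular d)

  n!<[1+n]! : ∀ {n} → 1 ≤ n → n ! < suc n !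
  n!<[1+n]! {n} 1≤n = ℕ.m<m+n (n !) (ℕ.*-mono-≤ 1≤n (ℕ.1≤n! n))

  !-increasing : ∀ {a b} → 1 ≤ a → a < b → a ! < b !
  !-increasing {a} {suc b} 1≤a (s≤s a≤b) with ℕ.m≤n⇒m<n∨m≡n a≤b
  ... | inj₁ a<b  = ℕ.<-trans (!-increasing 1≤a a<b) (n!<[1+n]! (ℕ.≤-trans 1≤a (ℕ.<⇒≤ a<b)))
  ... | inj₂ refl = n!<[1+n]! 1≤a

  𝔉-diag : ∀ d (i : Fin (suc d)) → 𝔉 d i i ≡ ℕ→ℚ (toℕ i !)
  𝔉-diag d i = cong ℕ→ℚ (trans (cong (toℕ i ! ℕ.*_) (S-diag (toℕ i))) (ℕ.*-identityʳ (toℕ i !)))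

  𝔉-upperTriangular : ∀ d → UpperTriangular (𝔉 d)
  𝔉-upperTriangular d i j j<i =
    cong ℕ→ℚ (trans (cong (toℕ i ! ℕ.*_) (S-vanishes (toℕ j) (toℕ i) j<i)) (ℕ.*-zeroʳ (toℕ i !)))

  𝔉-decoupled : ∀ d → Decoupled (𝔉 d)
  𝔉-decoupled d zero    = inj₁ first-row
    where
    first-row : ∀ j → 0 < toℕ j → 𝔉 d zero j ≡ 0ℚ
    first-row (suc j) _ = refl
  𝔉-decoupled d (suc i) = inj₂ (λ j i<j 𝔉jj≡𝔉ii → ℕ.<-irrefl
    (ℕ→ℚ-injective (trans (sym (𝔉-diag d (suc i))) (trans (sym 𝔉jj≡𝔉ii) (𝔉-diag d j))))
    (!-increasing (s≤s z≤n) i<j))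

  𝔉∼diag : ∀ d → Similar (𝔉 d) (diag (eigs d))
  𝔉∼diag d = Similar-respʳ {M = 𝔉 d} {diag (λ i → 𝔉 d i i)} {diag (eigs d)} diag-eigs
    (upperTriangular-diagonalisable (𝔉 d) (𝔉-upperTriangular d) (𝔉-decoupled d))
    where
    diag-eigs : diag (λ i → 𝔉 d i i) ≋ diag (eigs d)
    diag-eigs i j =
      trans (diag≡I* (λ i → 𝔉 d i i) i j) (trans (cong (I i j *_) (𝔉ᵢᵢ≡eigs j)) (sym (diag≡I* (eigs d) i j)))
      where
      𝔉ᵢᵢ≡eigs : ∀ i → 𝔉 d i i ≡ eigs d i
      𝔉ᵢᵢ≡eigs zero    = refl
      𝔉ᵢᵢ≡eigs (suc i) = 𝔉-diag d (suc i)

lemma4p3 : (d : ℕ) → 1 ≤ d →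
    Similar (𝔉 d) (ℌ d)
    × Similar (𝔉 d) (diag (eigs d))
    × Similar (ℌ d) (diag (eigs d))
lemma4p3 d _ =
  𝔉∼ℌ d ,
  𝔉∼diag d ,
  Similar-trans {M = ℌ d} {𝔉 d} {diag (eigs d)} (Similar-sym {M = 𝔉 d} {ℌ d} (𝔉∼ℌ d)) (𝔉∼diag d)
  where
  open Matrices using (Similar-sym; Similar-trans)
  open Similarity
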